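{- Let $M$ be a $0/\pm1$ matrix. If the bipartite graph $G(M)$ is a forest, then $(\mathrm{Part}(M),\preceq)$ is partially well-ordered (it contains no infinite antichain and no infinite strictly decreasing sequence).
   Context: For a matrix $P$ and integers $a\le b$, $c\le d$, $P_{[a,b)\times[c,d)}$ denotes the (possibly empty) submatrix of rows $a,\dots,b-1$ and columns $c,\dots,d-1$. A submatrix of a permutation matrix is increasing if its nonzero entries, listed in order of increasing row index, have strictly increasing column indices, and decreasing if strictly decreasing (a zero or empty submatrix is both). For an $r\times s$ matrix $M$ with entries in $\{0,1,-1\}$ and an $n\times n$ permutation matrix $P$, an $M$-partition of $P$ is a pair of multisets $I=\{1=i_1\le\dots\le i_{r+1}=n+1\}$, $J=\{1=j_1\le\dots\le j_{s+1}=n+1\}$ such that for all $k\in[r]$, $\ell\in[s]$: $P_{[i_k,i_{k+1})\times[j_\ell,j_{\ell+1})}$ is zero if $M_{k,\ell}=0$, increasing if $M_{k,\ell}=1$, decreasing if $M_{k,\ell}=-1$. $\mathrm{Part}(M)$ is the set of triples $(P,I,J)$ with $P$ a permutation matrix and $(I,J)$ an $M$-partition of $P$. For a matrix $P$, $\mathrm{supp}(P)$ is the set of positions of nonzero entries; for a finite set $X$ of positions, $\Delta(X)$ is the smallest $0/1$ matrix with support $X$, and $\mathrm{red}(Q)$ is obtained from $Q$ by deleting all all-zero rows and columns. For $(P,I,J),(P',I',J')\in\mathrm{Part}(M)$ with $I=\{i_1\le\dots\le i_{r+1}\}$, $J=\{j_1\le\dots\le j_{s+1}\}$, $I'=\{i'_1\le\dots\le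 i'_{r+1}\}$, $J'=\{j'_1\le\dots\le j'_{s+1}\}$, write $(P',I',J')\preceq(P,I,J)$ if there is $X\subseteq\mathrm{supp}(P)$ with $\mathrm{red}(\Delta(X))=P'$ and, for all $k\in[r],\ell\in[s]$, $|X\cap([i_k,i_{k+1})\times[j_\ell,j_{\ell+1}))|=|\mathrm{supp}(P')\cap([i'_k,i'_{k+1})\times[j'_\ell,j'_{\ell+1}))|$; this is a partial order. The bipartite graph $G(M)$ has vertices $x_1,\dots,x_r,y_1,\dots,y_s$ and an edge $x_iy_j$ whenever $M_{i,j}\ne0$. -}

module Defs where

open import Data.Nat using (ℕ; zero; suc; _+_; _≤_; _<_; _≤?_; _<?_)
open import Data.Fin using (Fin; zero; suc; toℕ; inject₁; fromℕ)
open import Data.Vec using (Vec; lookup; allFin; count)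
open import Data.Sum using (_⊎_; inj₁; inj₂)
open import Data.Product using (Σ; Σ-syntax; _×_; _,_; ∃)
open import Data.Product.Properties using ()
open import Relation.Nullary.Decidable using (_×-dec_)
open import Data.Empty using (⊥)
open import Relation.Nullary using (¬_)
open import Relation.Unary using (Pred; Decidable)
open import Relation.Binary.PropositionalEquality using (_≡_; _≢_)

data Entry : Set where
  zer pos neg : Entry

Matrix : ℕ → ℕ → Set
Matrix r s = Fin r → Fin s → Entry

Cycle : (V : Set) → (V → V → Set) → Set
Cycle V Adj =
  Σ[ k ∈ ℕ ] Σ[ v ∈ (Fin (suc (suc (suc k))) → V) ]
    (∀ a b → v a ≡ v b → a ≡ b)
    × (∀ (t : Fin (suc (suc k))) → Adj (v (inject₁ t)) (v (suc t)))
    × Adj (v (fromℕ (suc (suc k)))) (v zero)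

Forest : (V : Set) → (V → V → Set) → Set
Forest V Adj = ¬ Cycle V Adj

-- The bipartite graph G(M): vertices x₁..x_r (inj₁) and y₁..y_s (inj₂),
-- edge x_i y_j iff M i j ≠ 0.
GAdj : ∀ {r s} → Matrix r s → (Fin r ⊎ Fin s) → (Fin r ⊎ Fin s) → Set
GAdj M (inj₁ i) (inj₁ i') = ⊥
GAdj M (inj₁ i) (inj₂ j)  = M i j ≢ zer
GAdj M (inj₂ j) (inj₁ i)  = M i j ≢ zer
GAdj M (inj₂ j) (inj₂ j') = ⊥

GIsForest : ∀ {r s} → Matrix r s → Set
GIsForest {r} {s} M = Forest (Fin r ⊎ Fin s) (GAdj M)

-- Permutations, partitions
-- Rows/columns are indexed 0..n-1 (paper: 1..n); a permutation matrix P of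
-- size n is given by the vector π with P having its 1 in row i at column π[i].

IsPerm : ∀ {n} → Vec (Fin n) n → Set
IsPerm π = ∀ i j → lookup π i ≡ lookup π j → i ≡ j

-- I = {0 = i₁ ≤ … ≤ i_{m+1} = n} (paper: 1 = i₁ ≤ … ≤ i_{m+1} = n+1)
ValidBreaks : (n m : ℕ) → Vec ℕ (suc m) → Set
ValidBreaks n m I =
  lookup I zero ≡ 0 × lookup I (fromℕ m) ≡ n
  × (∀ (k : Fin m) → lookup I (inject₁ k) ≤ lookup I (suc k))

InBlock : ∀ {m} → Vec ℕ (suc m) → Fin m → ℕ → Set
InBlock I k x = lookup I (inject₁ k) ≤ x × x < lookup I (suc k)

inBlock? : ∀ {m} (I : Vec ℕ (suc m)) (k : Fin m) → Decidable (InBlock I k)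
inBlock? I k x = (lookup I (inject₁ k) ≤? x) ×-dec (x <? lookup I (suc k))

-- the nonzero entry of row i, (i, π[i]), lies in cell (k, ℓ)
InCell : ∀ {n r s} → Vec (Fin n) n → Vec ℕ (suc r) → Vec ℕ (suc s)
         → Fin r → Fin s → Fin n → Set
InCell π I J k ℓ i = InBlock I k (toℕ i) × InBlock J ℓ (toℕ (lookup π i))

inCell? : ∀ {n r s} (π : Vec (Fin n) n) (I : Vec ℕ (suc r)) (J : Vec ℕ (suc s))
          (k : Fin r) (ℓ : Fin s) → Decidable (InCell π I J k ℓ)
inCell? π I J k ℓ i = inBlock? I k (toℕ i) ×-dec inBlock? J ℓ (toℕ (lookup π i))

CellOK : ∀ {n} → Entry → Vec (Fin n) n → (Fin n → Set) → Set
CellOK zer π C = ∀ i → ¬ C i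
CellOK pos π C = ∀ i i' → C i → C i' → toℕ i < toℕ i'
                   → toℕ (lookup π i) < toℕ (lookup π i')
CellOK neg π C = ∀ i i' → C i → C i' → toℕ i < toℕ i'
                   → toℕ (lookup π i') < toℕ (lookup π i)

IsMPartition : ∀ {r s} → Matrix r s → (n : ℕ) → Vec (Fin n) n
               → Vec ℕ (suc r) → Vec ℕ (suc s) → Set
IsMPartition {r} {s} M n π I J =
  ValidBreaks n r I × ValidBreaks n s J
  × (∀ k ℓ → CellOK (M k ℓ) π (InCell π I J k ℓ))

record Part {r s : ℕ} (M : Matrix r s) : Set where
  constructor part
  field
    n      : ℕ
    perm   : Vec (Fin n) n
    isPerm : IsPerm perm
    I      : Vec ℕ (suc r)
    J      : Vec ℕ (suc s)
    isPart : IsMPartition M n perm I J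

-- the underlying data (P, I, J) of an element, used for equality
PartData : ℕ → ℕ → Set
PartData r s = Σ[ n ∈ ℕ ] Vec (Fin n) n × Vec ℕ (suc r) × Vec ℕ (suc s)

dataOf : ∀ {r s} {M : Matrix r s} → Part M → PartData r s
dataOf p = Part.n p , Part.perm p , Part.I p , Part.J p

countFin : ∀ {m ℓ} {C : Pred (Fin m) ℓ} → Decidable C → ℕ
countFin {m} C? = count C? (allFin m)

-- A subset X ⊆ supp(P) is given by its set of rows, enumerated in
-- increasing order by a strictly increasing map e : Fin n' → Fin n;
-- X = {(e c, π[e c])}.  red(Δ(X)) then has rows e 0 < … < e (n'-1), and the
-- 1 in row c sits in column = #{ c' | π[e c'] < π[e c] } (deleting the zero
-- columns).  red(Δ(X)) = P' says this is π'[c].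

_⪯_ : ∀ {r s} {M : Matrix r s} → Part M → Part M → Set
_⪯_ {r} {s} p' p =
  Σ[ e ∈ (Fin n' → Fin n) ]
    (∀ a b → toℕ a < toℕ b → toℕ (e a) < toℕ (e b))
    × (∀ c → toℕ (lookup π' c)
               ≡ countFin (λ c' → toℕ (lookup π (e c')) <? toℕ (lookup π (e c))))
    × (∀ (k : Fin r) (ℓ : Fin s) →
         countFin (λ c → inCell? π I J k ℓ (e c))
         ≡ countFin (inCell? π' I' J' k ℓ))
  where
  open Part p
  open Part p' renaming (n to n'; perm to π'; I to I'; J to J')
  π = perm

_≺_ : ∀ {r s} {M : Matrix r s} → Part M → Part M → Set
p' ≺ p = p' ⪯ p × ¬ (dataOf p' ≡ dataOf p)

NoInfiniteAntichain : ∀ {r s} (M : Matrix r s) → Set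
NoInfiniteAntichain M =
  ¬ (Σ[ f ∈ (ℕ → Part M) ] (∀ i j → i ≢ j → ¬ (f i ⪯ f j)))

NoInfiniteDescent : ∀ {r s} (M : Matrix r s) → Set
NoInfiniteDescent M =
  ¬ (Σ[ f ∈ (ℕ → Part M) ] (∀ i → f (suc i) ≺ f i))

PartiallyWellOrdered : ∀ {r s} (M : Matrix r s) → Set
PartiallyWellOrdered M = NoInfiniteAntichain M × NoInfiniteDescent M

-- The rows and columns of M (the lines) form the forest G(M), so they can be added one
-- leaf at a time: every line then has at most one neighbour added before it, and each
-- line can be given a direction such that in every nonzero cell the two lines agree when
-- the entry is 1 and disagree when it is -1. For an M-partition, inside each cell the
-- orders along its two lines (taken in their directions) then coincide, and inserting
-- the points stage by stage, each along the earlier of its two lines, lists all points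
-- so that every line lists its own points in its direction. Spelling this list by cells
-- gives a word over the finite alphabet of cells; a subword embedding maps points cell
-- by cell preserving the order on every line, hence the row and column orders, which is
-- exactly ⪯. So Higman's lemma rules out infinite antichains. An embedding between
-- partitions of the same size is the identity, and then the cell counts determine the
-- breakpoints, so a strictly decreasing chain strictly decreases the size.

module Submission where

open import Defs
open import Data.Nat using (ℕ)

open import Data.Bool.Base using (Bool; true; false; not; _xor_; _∧_; _∨_; if_then_else_)
open import Data.Bool.Properties
  using (T-≡; xor-assoc; xor-same; ∧-comm; ∧-identityʳ; ∧-zeroʳ; ∧-distribˡ-∨)
open import Data.Empty using (⊥; ⊥-elim)
open import Data.Fin.Base
  using (Fin; zero; suc; toℕ; inject₁; fromℕ; fromℕ<; join; splitAt; opposite; combine)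
open import Data.Fin.Properties
  using (suc-injective; toℕ-injective; toℕ<n; toℕ-inject₁; toℕ-fromℕ; toℕ-fromℕ<; toℕ-inject;
         splitAt-join; opposite-prop; opposite-involutive; combine-injective;
         pigeonhole; ¬∀⟶∃¬-smallest; ¬∀⟶∃¬; injective⇒≤)
  renaming (_≟_ to _≟ᶠ_; all? to allFin?)
open import Data.List.Base using (List; []; _∷_; filter; length; map; _++_; allFin)
open import Data.List.Properties using (filter-notAll)
open import Data.List.Membership.Propositional using (_∈_; find; lose)
open import Data.List.Membership.Propositional.Properties
  using (∈-filter⁺; ∈-filter⁻; ∈-map⁺; ∈-++⁺ˡ; ∈-++⁺ʳ; ∈-allFin)
import Data.List.Membership.DecPropositional as DecMembership
open import Data.List.Relation.Unary.All using (All; all?; []; _∷_)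
import Data.List.Relation.Unary.All as All
open import Data.List.Relation.Unary.All.Properties using (¬Any⇒All¬; All¬⇒¬Any)
open import Data.List.Relation.Unary.Any using (Any; here; there; any?)
import Data.List.Relation.Unary.Any as Any
open import Data.List.Relation.Unary.Unique.Propositional using (Unique; []; _∷_)
open import Data.List.Relation.Binary.Sublist.Heterogeneous using (Sublist; []; _∷ʳ_; _∷_; minimum)
open import Data.List.Relation.Binary.Sublist.Heterogeneous.Properties using (map⁻)
import Data.List.Relation.Binary.Sublist.DecPropositional as DecSublist
open import Data.Maybe.Base using (Maybe; just; nothing)
open import Data.Nat.Base using (zero; suc; _+_; _*_; _<_; _≤_; z≤n; s≤s; _<ᵇ_; _≡ᵇ_)
open import Data.Nat.Induction using (<-wellFounded)
import Data.Nat.Properties as ℕ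
open import Data.Nat.Properties
  using (_<?_; _≟_; ≤-refl; ≤-reflexive; ≤-pred; ≤-trans; <-trans; <-irrefl; <-≤-trans; ≤-<-trans;
         <⇒≤; <⇒≢; ≤∧≢⇒<; ≮⇒≥; <-cmp; n<1+n;
         m≤n⇒m≤1+n; m≤n⇒m<n∨m≡n; m<n⇒m<1+n; m≤n⇒∃[o]m+o≡n;
         +-suc; +-identityʳ; +-comm; +-cancelˡ-≡; +-monoʳ-<; +-mono-≤; ∸-monoʳ-<; ≡ᵇ⇒≡; <⇒<ᵇ)
open import Data.Product.Base using (∃-syntax; _×_; _,_; proj₁; proj₂) renaming (map to map-×)
open import Data.Sum.Base using (_⊎_; inj₁; inj₂)
open import Data.Sum.Properties using (≡-dec)
open import Data.Unit.Base using (⊤; tt)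
open import Data.Vec.Base using (Vec; _∷_; []; lookup; tabulate; count)
open import Data.Vec.Properties using (tabulate∘lookup; tabulate-cong)
open import Data.Vec.Functional using (updateAt)
open import Data.Vec.Functional.Properties using (updateAt-updates; updateAt-minimal)
open import Function.Base using (_∘_; const; id)
open import Function.Bundles using (Equivalence; _⇔_; mk⇔)
open import Induction.WellFounded using (Acc; acc)
open import Level using (0ℓ)
open import Relation.Binary.Definitions using (DecidableEquality; tri<; tri≈; tri>)
open import Relation.Binary.PropositionalEquality
  using (_≡_; _≢_; refl; sym; trans; cong; cong₂; subst; subst₂; module ≡-Reasoning)
open import Relation.Nullary using (¬_; Dec; yes; no; does)
open import Relation.Nullary.Decidable using (_×-dec_; _→-dec_; ¬?; decidable-stable)
open import Relation.Unary using (Pred; Decidable)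

open ≡-Reasoning

module SingleCoordinateDescent {X : Set} (_⊏_ : X → X → Set) where

  _◁_ : ∀ {m} → (Fin m → X) → (Fin m → X) → Set
  s′ ◁ s = ∃[ c ] (s′ c ⊏ s c × ∀ d → d ≢ c → s′ d ≡ s d)

  private
    acc-◁-cons : ∀ {m a} {t : Fin m → X} → Acc _⊏_ a → Acc _◁_ t →
                 ∀ s → s zero ≡ a → (∀ c → s (suc c) ≡ t c) → Acc _◁_ s
    acc-◁-cons {a = a} {t} (acc rec-a) (acc rec-t) s refl s-tail = acc smaller
      where
      smaller : ∀ {s′} → s′ ◁ s → Acc _◁_ s′
      smaller {s′} (zero , s′0⊏ , same) =
        acc-◁-cons (rec-a s′0⊏) (acc rec-t) s′ refl (λ c → trans (same (suc c) λ ()) (s-tail c))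
      smaller {s′} (suc c , s′c⊏ , same) =
        acc-◁-cons (acc rec-a)
          (rec-t (c , subst (s′ (suc c) ⊏_) (s-tail c) s′c⊏ ,
                  λ d d≢c → trans (same (suc d) (d≢c ∘ suc-injective)) (s-tail d)))
          s′ (same zero λ ()) (λ _ → refl)

  acc-◁ : ∀ m (s : Fin m → X) → (∀ c → Acc _⊏_ (s c)) → Acc _◁_ s
  acc-◁ zero    s _     = acc λ { (() , _) }
  acc-◁ (suc m) s acc-s =
    acc-◁-cons (acc-s zero) (acc-◁ m (λ c → s (suc c)) (λ c → acc-s (suc c)))
               s refl (λ _ → refl)

module Higman (m : ℕ) where
  open DecSublist (_≟ᶠ_ {m}) using (_⊆_; _⊆?_)

  Word : Set
  Word = List (Fin m)

  -- Sequences of words are stored newest first.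
  Dominates : Word → List Word → Set
  Dominates v ws = Any (_⊆ v) ws

  data Good : List Word → Set where
    good-here  : ∀ {w ws} → Dominates w ws → Good (w ∷ ws)
    good-there : ∀ {w ws} → Good ws → Good (w ∷ ws)

  good? : ∀ ws → Dec (Good ws)
  good? [] = no λ ()
  good? (w ∷ ws) with any? (_⊆? w) ws | good? ws
  ... | yes d | _     = yes (good-here d)
  ... | no _  | yes g = yes (good-there g)
  ... | no ¬d | no ¬g = no λ { (good-here d) → ¬d d ; (good-there g) → ¬g g }

  data Bar (ws : List Word) : Set where
    now   : Good ws → Bar ws
    later : (∀ w → Bar (w ∷ ws)) → Bar ws

  -- Prefixed a vs zs: zs arises from vs by prefixing some of its words with a
  -- (the newest one at least) and inserting arbitrary further words.
  data Prefixed (a : Fin m) : List Word → List Word → Set where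
    prefix-newest : ∀ {w zs} → Prefixed a (w ∷ zs) ((a ∷ w) ∷ zs)
    prefix-keep   : ∀ {w vs zs} → Prefixed a vs zs → Prefixed a (w ∷ vs) ((a ∷ w) ∷ zs)
    prefix-insert : ∀ {u vs zs} → Prefixed a vs zs → Prefixed a vs (u ∷ zs)

  dominates-prefixed : ∀ {a vs zs w} → Prefixed a vs zs → Dominates w vs → Dominates (a ∷ w) zs
  dominates-prefixed prefix-newest     (here w′⊆w) = here (refl ∷ w′⊆w)
  dominates-prefixed prefix-newest     (there d)   = there (Any.map (_ ∷ʳ_) d)
  dominates-prefixed (prefix-keep _)   (here w′⊆w) = here (refl ∷ w′⊆w)
  dominates-prefixed (prefix-keep p)   (there d)   = there (dominates-prefixed p d)
  dominates-prefixed (prefix-insert p) d           = there (dominates-prefixed p d)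

  good-prefixed : ∀ {a vs zs} → Prefixed a vs zs → Good vs → Good zs
  good-prefixed prefix-newest     (good-here d)  = good-here (Any.map (_ ∷ʳ_) d)
  good-prefixed prefix-newest     (good-there g) = good-there g
  good-prefixed (prefix-keep p)   (good-here d)  = good-here (dominates-prefixed p d)
  good-prefixed (prefix-keep p)   (good-there g) = good-there (good-prefixed p g)
  good-prefixed (prefix-insert p) g              = good-there (good-prefixed p g)

  -- The state of a letter a: nothing while no word starting with a has been seen,
  -- otherwise the (bad) sequence of the tails of those words.
  State : Set
  State = Maybe (List Word)

  _⊏_ : State → State → Set
  just ys ⊏ nothing = Bar ys
  just ys ⊏ just xs = ∃[ v ] (ys ≡ v ∷ xs × ¬ Good xs)
  nothing ⊏ _       = ⊥

  acc-just : ∀ {xs} → Bar xs → Acc _⊏_ (just xs)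
  acc-just (now g)   = acc λ { {just _} (_ , refl , ¬g) → ⊥-elim (¬g g) }
  acc-just (later b) = acc λ { {just _} (v , refl , _) → acc-just (b v) }

  acc-nothing : Acc _⊏_ nothing
  acc-nothing = acc λ { {just _} bar → acc-just bar }

  open SingleCoordinateDescent _⊏_

  Tracks : Fin m → State → List Word → Set
  Tracks a nothing   zs = ⊤
  Tracks a (just xs) zs = Prefixed a xs zs

  update : (Fin m → State) → Fin m → State → Fin m → State
  update st a x = updateAt st a (const x)

  update-◁ : ∀ st a {x} → x ⊏ st a → update st a x ◁ st
  update-◁ st a {x} x⊏ = a , subst (_⊏ st a) (sym (updateAt-updates a st)) x⊏ ,
                         λ b b≢a → updateAt-minimal b a st b≢a

  tracks-insert : ∀ {a x u zs} → Tracks a x zs → Tracks a x (u ∷ zs)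
  tracks-insert {x = nothing} _ = tt
  tracks-insert {x = just _}  p = prefix-insert p

  tracks-update : ∀ {zs st a u} x → Tracks a x (u ∷ zs) → (∀ b → Tracks b (st b) zs) →
                  ∀ b → Tracks b (update st a x b) (u ∷ zs)
  tracks-update {st = st} {a} x tx inv b with b ≟ᶠ a
  ... | yes refl = subst (λ y → Tracks a y _) (sym (updateAt-updates a st)) tx
  ... | no  b≢a  = subst (λ y → Tracks b y _) (sym (updateAt-minimal b a st b≢a)) (tracks-insert (inv b))

  -- The Coquand–Fridlender induction: on the states of all letters, ordered by ◁.
  bar-tracked : ∀ zs (st : Fin m → State) → Acc _◁_ st → (∀ a → Tracks a (st a) zs) → Bar zs
  bar-tracked zs st (acc rec) inv = later extend
    where
    extend : ∀ w → Bar (w ∷ zs)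
    extend []      = later λ _ → now (good-here (here (minimum _)))
    extend (a ∷ v) with st a in eq
    ... | nothing =
      bar-tracked _ (update st a (just (v ∷ zs)))
                  (rec (update-◁ st a (subst (just (v ∷ zs) ⊏_) (sym eq) (extend v))))
                  (tracks-update (just (v ∷ zs)) prefix-newest inv)
    ... | just xs with good? xs
    ...   | yes g  = now (good-there (good-prefixed (subst (λ x → Tracks a x zs) eq (inv a)) g))
    ...   | no ¬g  =
      bar-tracked _ (update st a (just (v ∷ xs)))
                  (rec (update-◁ st a (subst (just (v ∷ xs) ⊏_) (sym eq) (v , refl , ¬g))))
                  (tracks-update (just (v ∷ xs)) (prefix-keep (subst (λ x → Tracks a x zs) eq (inv a))) inv)

  bar-[] : Bar []
  bar-[] = bar-tracked [] (λ _ → nothing) (acc-◁ m _ (λ _ → acc-nothing)) (λ _ → tt)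

  higman : (f : ℕ → Word) → ∃[ i ] ∃[ j ] (i < j × f i ⊆ f j)
  higman f = bar-prefix 0 bar-[]
    where
    prefix : ℕ → List Word
    prefix zero    = []
    prefix (suc n) = f n ∷ prefix n

    dominated-earlier : ∀ {v} n → Dominates v (prefix n) → ∃[ i ] (i < n × f i ⊆ v)
    dominated-earlier (suc n) (here f⊆v) = n , ≤-refl , f⊆v
    dominated-earlier (suc n) (there d)  with i , i<n , f⊆v ← dominated-earlier n d =
      i , m<n⇒m<1+n i<n , f⊆v

    good-prefix : ∀ n → Good (prefix n) → ∃[ i ] ∃[ j ] (i < j × f i ⊆ f j)
    good-prefix (suc n) (good-here d)  with i , i<n , f⊆v ← dominated-earlier n d = i , n , i<n , f⊆v
    good-prefix (suc n) (good-there g) = good-prefix n g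

    bar-prefix : ∀ n → Bar (prefix n) → ∃[ i ] ∃[ j ] (i < j × f i ⊆ f j)
    bar-prefix n (now g)   = good-prefix n g
    bar-prefix n (later b) = bar-prefix (suc n) (b (f n))

xor-cancel : ∀ f d → f xor (f xor d) ≡ d
xor-cancel f d = trans (sym (xor-assoc f f d)) (cong (_xor d) (xor-same f))

module FiniteGraph {V : Set} (_≟_ : DecidableEquality V)
                   (Adj : V → V → Set) (adj? : ∀ u w → Dec (Adj u w)) (adj-irrefl : ∀ v → ¬ Adj v v)
                   {N : ℕ} (code : V → Fin N) (code-injective : ∀ {u w} → code u ≡ code w → u ≡ w)
                   where

  module _ (x : ℕ → V) (x-adj : ∀ t → Adj (x t) (x (suc t))) where

    closed-walk⇒cycle : ∀ i k → (∀ a b → a < i + suc (suc (suc k)) → b < i + suc (suc (suc k)) →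
                                  x a ≡ x b → a ≡ b) →
                        x (i + suc (suc (suc k))) ≡ x i → Cycle V Adj
    closed-walk⇒cycle i k distinct closed = k , v , v-injective , v-adj , v-closing
      where
      v : Fin (suc (suc (suc k))) → V
      v t = x (i + toℕ t)

      v-injective : ∀ a b → v a ≡ v b → a ≡ b
      v-injective a b va≡vb = toℕ-injective (+-cancelˡ-≡ i (toℕ a) (toℕ b)
        (distinct _ _ (+-monoʳ-< i (toℕ<n a)) (+-monoʳ-< i (toℕ<n b)) va≡vb))

      v-adj : ∀ (t : Fin (suc (suc k))) → Adj (v (inject₁ t)) (v (suc t))
      v-adj t = subst₂ Adj (cong (λ c → x (i + c)) (sym (toℕ-inject₁ t)))
                           (cong x (sym (+-suc i (toℕ t)))) (x-adj (i + toℕ t))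

      v-closing : Adj (v (fromℕ (suc (suc k)))) (v zero)
      v-closing = subst₂ Adj (cong (λ c → x (i + c)) (sym (toℕ-fromℕ (suc (suc k)))))
                    (trans (cong x (sym (+-suc i (suc (suc k)))))
                           (trans closed (cong x (sym (+-identityʳ i)))))
                    (x-adj (i + suc (suc k)))

    Fresh : ℕ → Set
    Fresh j = ∀ (i : Fin j) → x (toℕ i) ≢ x j

    fresh? : ∀ j → Dec (Fresh j)
    fresh? j = allFin? λ i → ¬? (x (toℕ i) ≟ x j)

    not-all-fresh : ¬ (∀ (j : Fin (suc N)) → Fresh (toℕ j))
    not-all-fresh all-fresh
      with i , j , i<j , same-code ← pigeonhole (n<1+n N) (code ∘ x ∘ toℕ)
      = all-fresh j (fromℕ< i<j) (trans (cong x (toℕ-fromℕ< i<j)) (code-injective same-code))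

    fresh-prefix-distinct : ∀ J → (∀ c → c < J → Fresh c) →
                            ∀ a b → a < J → b < J → x a ≡ x b → a ≡ b
    fresh-prefix-distinct J fresh a b a<J b<J xa≡xb with <-cmp a b
    ... | tri≈ _ a≡b _ = a≡b
    ... | tri< a<b _ _ = ⊥-elim (fresh b b<J (fromℕ< a<b) (trans (cong x (toℕ-fromℕ< a<b)) xa≡xb))
    ... | tri> _ _ b<a = ⊥-elim (fresh a a<J (fromℕ< b<a) (trans (cong x (toℕ-fromℕ< b<a)) (sym xa≡xb)))

    module _ (no-return : ∀ t → x (suc (suc t)) ≢ x t) where

      revisit⇒cycle : ∀ i o → x i ≡ x (i + suc o) →
                      (∀ a b → a < i + suc o → b < i + suc o → x a ≡ x b → a ≡ b) → Cycle V Adj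
      revisit⇒cycle i zero          closed _        =
        ⊥-elim (adj-irrefl (x i) (subst (Adj (x i)) (trans (cong x (sym (+-comm i 1))) (sym closed)) (x-adj i)))
      revisit⇒cycle i (suc zero)    closed _        =
        ⊥-elim (no-return i (trans (cong x (sym (+-comm i 2))) (sym closed)))
      revisit⇒cycle i (suc (suc k)) closed distinct = closed-walk⇒cycle i k distinct (sym closed)

      -- A walk that never immediately returns must revisit a vertex; the first
      -- revisit closes a cycle of length at least 3.
      non-backtracking-walk⇒cycle : Cycle V Adj
      non-backtracking-walk⇒cycle
        with j , ¬fresh-j , earlier-fresh
               ← ¬∀⟶∃¬-smallest (suc N) (Fresh ∘ toℕ) (fresh? ∘ toℕ) not-all-fresh
        with i , ¬xi≢xj ← ¬∀⟶∃¬ (toℕ j) _ (λ i → ¬? (x (toℕ i) ≟ x (toℕ j))) ¬fresh-j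
        with o , i+o≡j ← m≤n⇒∃[o]m+o≡n (toℕ<n i)
        = revisit⇒cycle (toℕ i) o
            (trans (decidable-stable (x (toℕ i) ≟ x (toℕ j)) ¬xi≢xj) (cong x (sym i+[1+o]≡j)))
            (subst (λ J → ∀ a b → a < J → b < J → x a ≡ x b → a ≡ b) (sym i+[1+o]≡j)
                   (fresh-prefix-distinct (toℕ j) fresh-below))
        where
        i+[1+o]≡j : toℕ i + suc o ≡ toℕ j
        i+[1+o]≡j = trans (+-suc (toℕ i) o) i+o≡j
        fresh-below : ∀ c → c < toℕ j → Fresh c
        fresh-below c c<j = subst Fresh (trans (toℕ-inject (fromℕ< c<j)) (toℕ-fromℕ< c<j))
                                  (earlier-fresh (fromℕ< c<j))

  Leaf : List V → V → Set
  Leaf S v = All (λ a → All (λ b → Adj v a → Adj v b → a ≡ b) S) S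

  leaf? : ∀ S v → Dec (Leaf S v)
  leaf? S v = all? (λ a → all? (λ b → adj? v a →-dec adj? v b →-dec a ≟ b) S) S

  leaf-unique : ∀ {S v a b} → Leaf S v → a ∈ S → b ∈ S → Adj v a → Adj v b → a ≡ b
  leaf-unique leaf a∈S b∈S = All.lookup (All.lookup leaf a∈S) b∈S

  module LeaflessWalk (S : List V) (leafless : ∀ {v} → v ∈ S → ¬ Leaf S v) where

    other-neighbour : ∀ p {c} → c ∈ S → ∃[ w ] (w ∈ S × Adj c w × w ≢ p)
    other-neighbour p {c} c∈S with any? (λ w → adj? c w ×-dec ¬? (w ≟ p)) S
    ... | yes found with w , w∈S , (c~w , w≢p) ← find found = w , w∈S , c~w , w≢p
    ... | no none = ⊥-elim (leafless c∈S (All.tabulate λ a∈S → All.tabulate λ b∈S c~a c~b →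
                      trans (only-p a∈S c~a) (sym (only-p b∈S c~b))))
      where
      only-p : ∀ {a} → a ∈ S → Adj c a → a ≡ p
      only-p {a} a∈S c~a with a ≟ p
      ... | yes a≡p = a≡p
      ... | no  a≢p = ⊥-elim (none (lose a∈S (c~a , a≢p)))

    record Step : Set where
      field
        from to  : V
        to∈S     : to ∈ S
        adjacent : Adj from to

    open Step

    step-avoiding : V → ∀ {c} → c ∈ S → Step
    step-avoiding p {c} c∈S with other ← other-neighbour p c∈S =
      record { from = c ; to = proj₁ other ; to∈S = proj₁ (proj₂ other)
             ; adjacent = proj₁ (proj₂ (proj₂ other)) }

    walk : ∀ {v} → v ∈ S → ℕ → Step
    walk {v} v∈S zero    = step-avoiding v v∈S
    walk     v∈S (suc t) = step-avoiding (from (walk v∈S t)) (to∈S (walk v∈S t))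

    cycle : ∀ {v} → v ∈ S → Cycle V Adj
    cycle v∈S = non-backtracking-walk⇒cycle (from ∘ walk v∈S) (adjacent ∘ walk v∈S)
                  (λ t → proj₂ (proj₂ (proj₂ (other-neighbour _ (to∈S (walk v∈S t))))))

  forest⇒leaf : Forest V Adj → ∀ S {v} → v ∈ S → ∃[ w ] (w ∈ S × Leaf S w)
  forest⇒leaf forest S v∈S with any? (leaf? S) S
  ... | yes leaf = find leaf
  ... | no ¬leaf = ⊥-elim (forest (LeaflessWalk.cycle S (λ v∈S leaf → ¬leaf (lose v∈S leaf)) v∈S))

  record Elimination (flips : V → V → Bool) (S : List V) : Set where
    field
      stage           : V → ℕ
      stage-injective : ∀ {a b} → a ∈ S → b ∈ S → stage a ≡ stage b → a ≡ b
      stage-bounded   : ∀ {a} → a ∈ S → stage a < length S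
      earlier-neighbour-unique :
        ∀ {y u w} → y ∈ S → u ∈ S → w ∈ S → Adj y u → Adj y w →
        stage u < stage y → stage w < stage y → u ≡ w
      direction            : V → Bool
      direction-consistent : ∀ {u w} → u ∈ S → w ∈ S → Adj u w →
                             direction u ≡ flips u w xor direction w

  module SignedForest (forest : Forest V Adj) (adj-sym : ∀ {u w} → Adj u w → Adj w u)
                      (flips : V → V → Bool) (flips-sym : ∀ u w → flips u w ≡ flips w u) where

    -- The leaf v is eliminated last: it gets the largest stage, and its direction
    -- is forced by its (at most one) neighbour.
    module AddLeaf (S : List V) (v : V) (v∈S : v ∈ S) (leaf : Leaf S v) where

      S∖v : List V
      S∖v = filter (λ a → ¬? (a ≟ v)) S

      S∖v-shorter : length S∖v < length S
      S∖v-shorter = filter-notAll (λ a → ¬? (a ≟ v)) S (lose v∈S λ v≢v → v≢v refl)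

      split : ∀ {a} → a ∈ S → a ≡ v ⊎ (a ∈ S∖v × a ≢ v)
      split {a} a∈S with a ≟ v
      ... | yes a≡v = inj₁ a≡v
      ... | no  a≢v = inj₂ (∈-filter⁺ (λ a → ¬? (a ≟ v)) a∈S a≢v , a≢v)

      ∈S∖v⇒∈S : ∀ {a} → a ∈ S∖v → a ∈ S
      ∈S∖v⇒∈S = proj₁ ∘ ∈-filter⁻ (λ a → ¬? (a ≟ v))

      override : {B : Set} → B → (V → B) → V → B
      override b f a with a ≟ v
      ... | yes _ = b
      ... | no  _ = f a

      override-v : ∀ {B} {b : B} {f} → override b f v ≡ b
      override-v with v ≟ v
      ... | yes _   = refl
      ... | no  v≢v = ⊥-elim (v≢v refl)

      override-other : ∀ {B} {b : B} {f a} → a ≢ v → override b f a ≡ f a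
      override-other {a = a} a≢v with a ≟ v
      ... | yes a≡v = ⊥-elim (a≢v a≡v)
      ... | no  _   = refl

      module _ (E : Elimination flips S∖v) where
        open Elimination E

        direction-v : Bool
        direction-v with any? (adj? v) S∖v
        ... | yes found = flips v (proj₁ (find found)) xor direction (proj₁ (find found))
        ... | no  _     = true

        direction-v-consistent : ∀ {w} → w ∈ S∖v → Adj v w → direction-v ≡ flips v w xor direction w
        direction-v-consistent {w} w∈ v~w with any? (adj? v) S∖v
        ... | no none = ⊥-elim (none (lose w∈ v~w))
        ... | yes found with u , u∈ , v~u ← find found
                        with refl ← leaf-unique leaf (∈S∖v⇒∈S u∈) (∈S∖v⇒∈S w∈) v~u v~w = refl

        stage′ : V → ℕ
        stage′ = override (length S∖v) stage

        direction′ : V → Bool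
        direction′ = override direction-v direction

        stage′-injective : ∀ {a b} → a ∈ S → b ∈ S → stage′ a ≡ stage′ b → a ≡ b
        stage′-injective a∈S b∈S eq with split a∈S | split b∈S
        ... | inj₁ refl       | inj₁ refl       = refl
        ... | inj₁ refl       | inj₂ (b∈ , b≢v) =
          ⊥-elim (<-irrefl (trans (sym (override-other b≢v)) (trans (sym eq) override-v)) (stage-bounded b∈))
        ... | inj₂ (a∈ , a≢v) | inj₁ refl       =
          ⊥-elim (<-irrefl (trans (sym (override-other a≢v)) (trans eq override-v)) (stage-bounded a∈))
        ... | inj₂ (a∈ , a≢v) | inj₂ (b∈ , b≢v) =
          stage-injective a∈ b∈ (trans (sym (override-other a≢v)) (trans eq (override-other b≢v)))

        stage′-bounded : ∀ {a} → a ∈ S → stage′ a < length S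
        stage′-bounded a∈S with split a∈S
        ... | inj₁ refl       = subst (_< length S) (sym override-v) S∖v-shorter
        ... | inj₂ (a∈ , a≢v) =
          subst (_< length S) (sym (override-other a≢v)) (<-trans (stage-bounded a∈) S∖v-shorter)

        earlier-than-remaining : ∀ {y z} → y ∈ S∖v → y ≢ v → z ∈ S → stage′ z < stage′ y →
                                 z ∈ S∖v × stage z < stage y
        earlier-than-remaining {y} y∈ y≢v z∈S z<y with split z∈S
        ... | inj₁ refl = ⊥-elim (<-irrefl refl
                            (<-trans (subst (_< length S∖v) (sym (override-other y≢v)) (stage-bounded y∈))
                                     (subst (_< stage′ y) override-v z<y)))
        ... | inj₂ (z∈ , z≢v) = z∈ , subst₂ _<_ (override-other z≢v) (override-other y≢v) z<y

        earlier-neighbour-unique′ : ∀ {y u w} → y ∈ S → u ∈ S → w ∈ S → Adj y u → Adj y w →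
                                    stage′ u < stage′ y → stage′ w < stage′ y → u ≡ w
        earlier-neighbour-unique′ y∈S u∈S w∈S y~u y~w u<y w<y with split y∈S
        ... | inj₁ refl       = leaf-unique leaf u∈S w∈S y~u y~w
        ... | inj₂ (y∈ , y≢v)
          with u∈ , u<y′ ← earlier-than-remaining y∈ y≢v u∈S u<y
          with w∈ , w<y′ ← earlier-than-remaining y∈ y≢v w∈S w<y
          = earlier-neighbour-unique y∈ u∈ w∈ y~u y~w u<y′ w<y′

        direction′-consistent : ∀ {u w} → u ∈ S → w ∈ S → Adj u w →
                                direction′ u ≡ flips u w xor direction′ w
        direction′-consistent {u} {w} u∈S w∈S u~w with split u∈S | split w∈S
        ... | inj₁ refl       | inj₁ refl       = ⊥-elim (adj-irrefl _ u~w)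
        ... | inj₁ refl       | inj₂ (w∈ , w≢v) =
          trans override-v (trans (direction-v-consistent w∈ u~w)
                                  (cong (flips v _ xor_) (sym (override-other w≢v))))
        ... | inj₂ (u∈ , u≢v) | inj₁ refl       = begin
          direction′ u
            ≡⟨ override-other u≢v ⟩
          direction u
            ≡⟨ xor-cancel (flips u v) (direction u) ⟨
          flips u v xor (flips u v xor direction u)
            ≡⟨ cong (λ f → flips u v xor (f xor direction u)) (flips-sym u v) ⟩
          flips u v xor (flips v u xor direction u)
            ≡⟨ cong (flips u v xor_) (direction-v-consistent u∈ (adj-sym u~w)) ⟨
          flips u v xor direction-v
            ≡⟨ cong (flips u v xor_) override-v ⟨
          flips u v xor direction′ v
            ∎
        ... | inj₂ (u∈ , u≢v) | inj₂ (w∈ , w≢v) =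
          trans (override-other u≢v) (trans (direction-consistent u∈ w∈ u~w)
                                            (cong (flips _ _ xor_) (sym (override-other w≢v))))

        add-leaf : Elimination flips S
        add-leaf = record
          { stage = stage′ ; stage-injective = stage′-injective ; stage-bounded = stage′-bounded
          ; earlier-neighbour-unique = earlier-neighbour-unique′
          ; direction = direction′ ; direction-consistent = direction′-consistent }

    elimination : ∀ n S → length S ≤ n → Elimination flips S
    elimination _ [] _ = record
      { stage = λ _ → 0 ; stage-injective = λ () ; stage-bounded = λ ()
      ; earlier-neighbour-unique = λ ()
      ; direction = λ _ → true ; direction-consistent = λ () }
    elimination (suc n) S@(_ ∷ _) |S|≤1+n
      with v , v∈S , leaf ← forest⇒leaf forest S (here refl) =
      AddLeaf.add-leaf S v v∈S leaf
        (elimination n _ (≤-pred (≤-trans (AddLeaf.S∖v-shorter S v v∈S leaf) |S|≤1+n)))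

-- The rows and columns of M are the vertices of G(M); in an M-partition they
-- index the row blocks and column blocks, which we call lines.
module LinesOf {r s} (M : Matrix r s) where

  Line : Set
  Line = Fin r ⊎ Fin s

  _≟ᴸ_ : DecidableEquality Line
  _≟ᴸ_ = ≡-dec _≟ᶠ_ _≟ᶠ_

  isZero? : ∀ e → Dec (e ≡ zer)
  isZero? zer = yes refl
  isZero? pos = no λ ()
  isZero? neg = no λ ()

  adj? : ∀ u w → Dec (GAdj M u w)
  adj? (inj₁ _) (inj₁ _) = no λ ()
  adj? (inj₁ k) (inj₂ ℓ) = ¬? (isZero? (M k ℓ))
  adj? (inj₂ ℓ) (inj₁ k) = ¬? (isZero? (M k ℓ))
  adj? (inj₂ _) (inj₂ _) = no λ ()

  adj-irrefl : ∀ v → ¬ GAdj M v v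
  adj-irrefl (inj₁ _) ()
  adj-irrefl (inj₂ _) ()

  adj-sym : ∀ {u w} → GAdj M u w → GAdj M w u
  adj-sym {inj₁ _} {inj₂ _} u~w = u~w
  adj-sym {inj₂ _} {inj₁ _} u~w = u~w

  isNeg : Entry → Bool
  isNeg neg = true
  isNeg _   = false

  flips : Line → Line → Bool
  flips (inj₁ k) (inj₂ ℓ) = isNeg (M k ℓ)
  flips (inj₂ ℓ) (inj₁ k) = isNeg (M k ℓ)
  flips _        _        = false

  flips-sym : ∀ u w → flips u w ≡ flips w u
  flips-sym (inj₁ _) (inj₁ _) = refl
  flips-sym (inj₁ _) (inj₂ _) = refl
  flips-sym (inj₂ _) (inj₁ _) = refl
  flips-sym (inj₂ _) (inj₂ _) = refl

  lines : List Line
  lines = map inj₁ (allFin r) ++ map inj₂ (allFin s)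

  ∈-lines : ∀ v → v ∈ lines
  ∈-lines (inj₁ k) = ∈-++⁺ˡ (∈-map⁺ inj₁ (∈-allFin k))
  ∈-lines (inj₂ ℓ) = ∈-++⁺ʳ (map inj₁ (allFin r)) (∈-map⁺ inj₂ (∈-allFin ℓ))

  join-injective : ∀ {u w} → join r s u ≡ join r s w → u ≡ w
  join-injective {u} {w} eq = trans (sym (splitAt-join r s u)) (trans (cong (splitAt r) eq) (splitAt-join r s w))

  open FiniteGraph _≟ᴸ_ (GAdj M) adj? adj-irrefl (join r s) join-injective
    using (module SignedForest) renaming (Elimination to EliminationOf; module Elimination to EliminationOf)

  LinesElimination : Set
  LinesElimination = EliminationOf flips lines

  module LinesElimination = EliminationOf

  lines-elimination : GIsForest M → LinesElimination
  lines-elimination forest = SignedForest.elimination forest adj-sym flips flips-sym _ lines ≤-refl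

Nondecreasing : ∀ {m} → Vec ℕ (suc m) → Set
Nondecreasing {m} I = ∀ (k : Fin m) → lookup I (inject₁ k) ≤ lookup I (suc k)

lookup-mono : ∀ {m} (I : Vec ℕ (suc m)) → Nondecreasing I →
              ∀ a b → toℕ a ≤ toℕ b → lookup I a ≤ lookup I b
lookup-mono {zero}  (_ ∷ []) _    zero    zero    _         = ≤-refl
lookup-mono {suc _} (_ ∷ I)  _    zero    zero    _         = ≤-refl
lookup-mono {suc _} (_ ∷ I)  mono zero    (suc b) _         =
  ≤-trans (mono zero) (lookup-mono I (mono ∘ suc) zero b z≤n)
lookup-mono {suc _} (_ ∷ I)  mono (suc a) (suc b) (s≤s a≤b) = lookup-mono I (mono ∘ suc) a b a≤b

inBlock-exists : ∀ {m} (I : Vec ℕ (suc m)) → Nondecreasing I →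
                 ∀ x → lookup I zero ≤ x → x < lookup I (fromℕ m) → ∃[ k ] InBlock I k x
inBlock-exists {zero}  (_ ∷ []) _    x lo≤x x<hi = ⊥-elim (<-irrefl refl (≤-<-trans lo≤x x<hi))
inBlock-exists {suc _} (_ ∷ I)  mono x lo≤x x<hi with x <? lookup I zero
... | yes x<next = zero , lo≤x , x<next
... | no  x≮next with k , x∈k ← inBlock-exists I (mono ∘ suc) x (≮⇒≥ x≮next) x<hi = suc k , x∈k

inBlock-valid : ∀ {n m I} → ValidBreaks n m I → ∀ x → x < n → ∃[ k ] InBlock I k x
inBlock-valid {I = I} (lo≡0 , hi≡n , mono) x x<n =
  inBlock-exists I mono x (subst (_≤ x) (sym lo≡0) z≤n) (subst (x <_) (sym hi≡n) x<n)

module Blocks {m : ℕ} {I : Vec ℕ (suc m)} (mono : Nondecreasing I) where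

  inBlock-< : ∀ {k k′ a b} → InBlock I k a → InBlock I k′ b → toℕ k < toℕ k′ → a < b
  inBlock-< {k} {k′} (_ , a<) (b≥ , _) k<k′ =
    <-≤-trans a< (≤-trans (lookup-mono I mono (suc k) (inject₁ k′)
                                        (subst (suc (toℕ k) ≤_) (sym (toℕ-inject₁ k′)) k<k′))
                          b≥)

  inBlock-unique : ∀ {k k′ a} → InBlock I k a → InBlock I k′ a → k ≡ k′
  inBlock-unique {k} {k′} a∈k a∈k′ with <-cmp (toℕ k) (toℕ k′)
  ... | tri< k<k′ _ _ = ⊥-elim (<-irrefl refl (inBlock-< a∈k a∈k′ k<k′))
  ... | tri≈ _ k≡k′ _ = toℕ-injective k≡k′
  ... | tri> _ _ k′<k = ⊥-elim (<-irrefl refl (inBlock-< a∈k′ a∈k k′<k))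

  <-lookup⇒ : ∀ {k x} → InBlock I k x → ∀ j → x < lookup I j → toℕ k < toℕ j
  <-lookup⇒ {k} {x} (x≥ , _) j x<Ij with toℕ k <? toℕ j
  ... | yes k<j = k<j
  ... | no  k≮j = ⊥-elim (<-irrefl refl (<-≤-trans x<Ij (≤-trans
          (lookup-mono I mono j (inject₁ k) (subst (toℕ j ≤_) (sym (toℕ-inject₁ k)) (≮⇒≥ k≮j)))
          x≥)))

  <-lookup⇐ : ∀ {k x} → InBlock I k x → ∀ j → toℕ k < toℕ j → x < lookup I j
  <-lookup⇐ {k} (_ , x<) j k<j = <-≤-trans x< (lookup-mono I mono (suc k) j k<j)

lookup-≤ : ∀ {n m I} → ValidBreaks n m I → ∀ j → lookup I j ≤ n
lookup-≤ {n} {m} {I} (_ , hi≡n , mono) j =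
  subst (lookup I j ≤_) hi≡n
        (lookup-mono I mono j (fromℕ m) (subst (toℕ j ≤_) (sym (toℕ-fromℕ m)) (≤-pred (toℕ<n j))))

blockwise-monotone :
  ∀ {A B : Set} {m} {I I′ : Vec ℕ (suc m)} → Nondecreasing I → Nondecreasing I′ →
  (κ : A → ℕ) (κ′ : B → ℕ) (blk : A → Fin m) (blk′ : B → Fin m) →
  (∀ a → InBlock I (blk a) (κ a)) → (∀ b → InBlock I′ (blk′ b) (κ′ b)) →
  (φ : A → B) → (∀ a → blk a ≡ blk′ (φ a)) →
  (∀ a b → blk a ≡ blk b → κ a < κ b → κ′ (φ a) < κ′ (φ b)) →
  ∀ a b → κ a < κ b → κ′ (φ a) < κ′ (φ b)
blockwise-monotone {I = I} {I′} mono mono′ κ κ′ blk blk′ blk-∈ blk′-∈ φ φ-blk inside a b κa<κb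
  with <-cmp (toℕ (blk a)) (toℕ (blk b))
... | tri≈ _ same _ = inside a b (toℕ-injective same) κa<κb
... | tri> _ _ b<a  =
  ⊥-elim (<-irrefl refl (<-trans κa<κb (Blocks.inBlock-< {I = I} mono (blk-∈ b) (blk-∈ a) b<a)))
... | tri< a<b _ _  = Blocks.inBlock-< {I = I′} mono′ (in-φ-block a) (in-φ-block b) a<b
  where
  in-φ-block : ∀ c → InBlock I′ (blk c) (κ′ (φ c))
  in-φ-block c = subst (λ k → InBlock I′ k (κ′ (φ c))) (sym (φ-blk c)) (blk′-∈ (φ c))

_<[_]_ : ℕ → Bool → ℕ → Set
a <[ true  ] b = a < b
a <[ false ] b = b < a

_<[_]?_ : ∀ a d b → Dec (a <[ d ] b)
a <[ true  ]? b = a <? b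
a <[ false ]? b = b <? a

<[]-trans : ∀ {d a b c} → a <[ d ] b → b <[ d ] c → a <[ d ] c
<[]-trans {true}  a<b b<c = <-trans a<b b<c
<[]-trans {false} b<a c<b = <-trans c<b b<a

<[]-irrefl : ∀ {d a} → ¬ a <[ d ] a
<[]-irrefl {true}  = <-irrefl refl
<[]-irrefl {false} = <-irrefl refl

<[]-total : ∀ {d a b} → a ≢ b → a <[ d ] b ⊎ b <[ d ] a
<[]-total {d} {a} {b} a≢b with <-cmp a b | d
... | tri< a<b _ _ | true  = inj₁ a<b
... | tri< a<b _ _ | false = inj₂ a<b
... | tri≈ _ a≡b _ | _     = ⊥-elim (a≢b a≡b)
... | tri> _ _ b<a | true  = inj₂ b<a
... | tri> _ _ b<a | false = inj₁ b<a

-- A map that is increasing (t = false) or decreasing (t = true) turns the order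
-- in direction t xor d into the order in direction d.
<[]-twist : ∀ t d {a b a′ b′} → (a < b → a′ <[ not t ] b′) → (b < a → b′ <[ not t ] a′) →
            a <[ t xor d ] b → a′ <[ d ] b′
<[]-twist false true  mono _    a<b = mono a<b
<[]-twist false false _    mono b<a = mono b<a
<[]-twist true  true  _    mono b<a = mono b<a
<[]-twist true  false mono _    a<b = mono a<b

<[]⇒< : ∀ d {x y x′ y′} → (x <[ d ] y → x′ <[ d ] y′) → (y <[ d ] x → y′ <[ d ] x′) →
        x < y → x′ < y′
<[]⇒< true  forward _        = forward
<[]⇒< false _       backward = backward

data Before {X : Set} (a b : X) : List X → Set where
  before-here  : ∀ {L} → b ∈ L → Before a b (a ∷ L)
  before-there : ∀ {c L} → Before a b L → Before a b (c ∷ L)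

module _ {X : Set} where

  before-∈ʳ : ∀ {a b : X} {L} → Before a b L → b ∈ L
  before-∈ʳ (before-here b∈L)  = there b∈L
  before-∈ʳ (before-there a<b) = there (before-∈ʳ a<b)

  before-asym : ∀ {a b : X} {L} → Unique L → Before a b L → ¬ Before b a L
  before-asym (a∉L ∷ _) (before-here b∈L)  (before-here a∈L)  = All¬⇒¬Any a∉L a∈L
  before-asym (a∉L ∷ _) (before-here _)    (before-there b<a) = All¬⇒¬Any a∉L (before-∈ʳ b<a)
  before-asym (b∉L ∷ _) (before-there a<b) (before-here _)    = All¬⇒¬Any b∉L (before-∈ʳ a<b)
  before-asym (_ ∷ u)   (before-there a<b) (before-there b<a) = before-asym u a<b b<a

  before-irrefl : ∀ {a : X} {L} → Unique L → ¬ Before a a L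
  before-irrefl u a<a = before-asym u a<a a<a

  module Insertion {On : X → Set} {Lt : X → X → Set}
                   (On? : ∀ x → Dec (On x)) (Lt? : ∀ x y → Dec (Lt x y)) where

    insert : X → List X → List X
    insert x []      = x ∷ []
    insert x (z ∷ L) with On? z ×-dec Lt? x z
    ... | yes _ = x ∷ z ∷ L
    ... | no  _ = z ∷ insert x L

    insert-new : ∀ x L → x ∈ insert x L
    insert-new x []      = here refl
    insert-new x (z ∷ L) with On? z ×-dec Lt? x z
    ... | yes _ = here refl
    ... | no  _ = there (insert-new x L)

    insert-old : ∀ {x y} L → y ∈ L → y ∈ insert x L
    insert-old {x} (z ∷ L) y∈ with On? z ×-dec Lt? x z
    ... | yes _ = there y∈
    insert-old     (z ∷ L) (here y≡z)  | no _ = here y≡z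
    insert-old     (z ∷ L) (there y∈L) | no _ = there (insert-old L y∈L)

    insert-∈ : ∀ {x y} L → y ∈ insert x L → y ≡ x ⊎ y ∈ L
    insert-∈ []      (here y≡x) = inj₁ y≡x
    insert-∈ {x} (z ∷ L) y∈ with On? z ×-dec Lt? x z
    insert-∈ (z ∷ L) (here y≡x)  | yes _ = inj₁ y≡x
    insert-∈ (z ∷ L) (there y∈L) | yes _ = inj₂ y∈L
    insert-∈ (z ∷ L) (here y≡z)  | no _  = inj₂ (here y≡z)
    insert-∈ (z ∷ L) (there y∈)  | no _  with insert-∈ L y∈
    ... | inj₁ y≡x = inj₁ y≡x
    ... | inj₂ y∈L = inj₂ (there y∈L)

    insert-unique : ∀ {x L} → ¬ x ∈ L → Unique L → Unique (insert x L)
    insert-unique {L = []}    _   _ = [] ∷ []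
    insert-unique {x} {z ∷ L} x∉ (z∉L ∷ u) with On? z ×-dec Lt? x z
    ... | yes _ = ¬Any⇒All¬ _ x∉ ∷ z∉L ∷ u
    ... | no  _ = ¬Any⇒All¬ _ z∉ ∷ insert-unique (x∉ ∘ there) u
      where
      z∉ : ¬ z ∈ insert x L
      z∉ z∈ with insert-∈ L z∈
      ... | inj₁ refl = x∉ (here refl)
      ... | inj₂ z∈L  = All¬⇒¬Any z∉L z∈L

    insert-before : ∀ {x a b L} → Before a b L → Before a b (insert x L)
    insert-before {x} {L = z ∷ L} a<b with On? z ×-dec Lt? x z
    ... | yes _ = before-there a<b
    insert-before {L = z ∷ L} (before-here b∈L)  | no _ = before-here (insert-old L b∈L)
    insert-before {L = z ∷ L} (before-there a<b) | no _ = before-there (insert-before a<b)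

    Sorted : List X → Set
    Sorted L = ∀ {a b} → a ∈ L → b ∈ L → On a → On b → Lt a b → Before a b L

    module _ (Lt-trans : ∀ {a b c} → Lt a b → Lt b c → Lt a c) (Lt-irrefl : ∀ {a} → ¬ Lt a a)
             (Lt-total : ∀ {a b} → On a → On b → a ≢ b → Lt a b ⊎ Lt b a) where

      sorted-tail : ∀ {y L} → Unique (y ∷ L) → Sorted (y ∷ L) → Sorted L
      sorted-tail (y∉L ∷ _) sorted a∈ b∈ oa ob a<b with sorted (there a∈) (there b∈) oa ob a<b
      ... | before-here _    = ⊥-elim (All¬⇒¬Any y∉L a∈)
      ... | before-there a≺b = a≺b

      insert-sorted : ∀ {x L} → ¬ x ∈ L → Unique L → Sorted L → On x →
                      (∀ {z} → z ∈ L → On z → Lt z x → Before z x (insert x L)) ×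
                      (∀ {z} → z ∈ L → On z → Lt x z → Before x z (insert x L))
      insert-sorted {x} {[]}    _  _ _ _ = (λ ()) , (λ ())
      insert-sorted {x} {y ∷ L} x∉ u@(y∉L ∷ u′) sorted ox with On? y ×-dec Lt? x y
      ... | yes (oy , x<y) = smaller , (λ z∈ _ _ → before-here z∈)
        where
        smaller : ∀ {z} → z ∈ y ∷ L → On z → Lt z x → Before z x (x ∷ y ∷ L)
        smaller (here refl) _ z<x = ⊥-elim (Lt-irrefl (Lt-trans x<y z<x))
        smaller {z} (there z∈L) oz z<x with Lt-total oz oy (λ { refl → All¬⇒¬Any y∉L z∈L })
        ... | inj₁ z<y = ⊥-elim (before-asym u (sorted (there z∈L) (here refl) oz oy z<y) (before-here z∈L))
        ... | inj₂ y<z = ⊥-elim (Lt-irrefl (Lt-trans x<y (Lt-trans y<z z<x)))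
      ... | no ¬y-after = smaller , larger
        where
        IH : (∀ {z} → z ∈ L → On z → Lt z x → Before z x (insert x L)) ×
             (∀ {z} → z ∈ L → On z → Lt x z → Before x z (insert x L))
        IH = insert-sorted (x∉ ∘ there) u′ (sorted-tail u sorted) ox
        smaller : ∀ {z} → z ∈ y ∷ L → On z → Lt z x → Before z x (y ∷ insert x L)
        smaller (here refl)  _  _   = before-here (insert-new x L)
        smaller (there z∈L) oz z<x = before-there (proj₁ IH z∈L oz z<x)
        larger : ∀ {z} → z ∈ y ∷ L → On z → Lt x z → Before x z (y ∷ insert x L)
        larger (here refl)  oz x<z = ⊥-elim (¬y-after (oz , x<z))
        larger (there z∈L) oz x<z = before-there (proj₂ IH z∈L oz x<z)

module SublistImage {X Y : Set} (_≟_ : DecidableEquality X) {R : X → Y → Set} where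

  image : ∀ {A B} → Sublist R A B → ∀ {x} → x ∈ A → Y
  image (_ ∷ʳ p)              x∈A = image p x∈A
  image (_∷_ {x = a} {y = y} _ p) {x} x∈A with x ≟ a
  ... | yes _ = y
  ... | no  x≢a = image p (tail-∈ x≢a x∈A)
    where
    tail-∈ : ∀ {L} → x ≢ a → x ∈ a ∷ L → x ∈ L
    tail-∈ x≢a (here x≡a) = ⊥-elim (x≢a x≡a)
    tail-∈ _   (there x∈) = x∈

  image-R : ∀ {A B} (p : Sublist R A B) {x} (x∈A : x ∈ A) → R x (image p x∈A)
  image-R (_ ∷ʳ p)              x∈A = image-R p x∈A
  image-R (_∷_ {x = a} r p) {x} x∈A with x ≟ a
  ... | yes refl = r
  ... | no  _    = image-R p _

  image-∈ : ∀ {A B} (p : Sublist R A B) {x} (x∈A : x ∈ A) → image p x∈A ∈ B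
  image-∈ (_ ∷ʳ p)              x∈A = there (image-∈ p x∈A)
  image-∈ (_∷_ {x = a} r p) {x} x∈A with x ≟ a
  ... | yes _ = here refl
  ... | no  _ = there (image-∈ p _)

  image-before : ∀ {A B} (p : Sublist R A B) → Unique A → ∀ {x x′} → Before x x′ A →
                 (x∈A : x ∈ A) (x′∈A : x′ ∈ A) → Before (image p x∈A) (image p x′∈A) B
  image-before (_ ∷ʳ p) u x<x′ x∈A x′∈A = before-there (image-before p u x<x′ x∈A x′∈A)
  image-before (_∷_ {x = a} r p) u@(a∉ ∷ u′) {x} {x′} x<x′ x∈A x′∈A with x ≟ a | x′ ≟ a
  ... | yes refl | yes refl = ⊥-elim (before-irrefl u x<x′)
  ... | yes refl | no  _    = before-here (image-∈ p _)
  ... | no  x≢a  | yes refl = ⊥-elim (x≢a (head-equal x<x′))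
    where
    head-equal : Before x a (a ∷ _) → x ≡ a
    head-equal (before-here _)    = refl
    head-equal (before-there x<a) = ⊥-elim (All¬⇒¬Any a∉ (before-∈ʳ x<a))
  ... | no  x≢a  | no  _    = before-there (image-before p u′ (from-tail x<x′) _ _)
    where
    from-tail : Before x x′ (a ∷ _) → Before x x′ _
    from-tail (before-here _)    = ⊥-elim (x≢a refl)
    from-tail (before-there x<x′) = x<x′

cnt : ∀ {n} → (Fin n → Bool) → ℕ
cnt {zero}  _ = 0
cnt {suc n} b = (if b zero then suc else id) (cnt (b ∘ suc))

count-tabulate : ∀ {n} {A : Set} {P : Pred A 0ℓ} (P? : Decidable P) (f : Fin n → A) →
                 count P? (tabulate f) ≡ cnt (λ i → does (P? (f i)))
count-tabulate {zero}  P? f = refl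
count-tabulate {suc n} P? f with does (P? (f zero))
... | true  = cong suc (count-tabulate P? (f ∘ suc))
... | false = count-tabulate P? (f ∘ suc)

countFin≡cnt : ∀ {n} {P : Pred (Fin n) 0ℓ} (P? : Decidable P) → countFin P? ≡ cnt (does ∘ P?)
countFin≡cnt P? = count-tabulate P? id

cnt-cong : ∀ {n} {b c : Fin n → Bool} → (∀ i → b i ≡ c i) → cnt b ≡ cnt c
cnt-cong {zero}          _  = refl
cnt-cong {suc n} {b} {c} eq with b zero | c zero | eq zero
... | true  | true  | refl = cong suc (cnt-cong (eq ∘ suc))
... | false | false | refl = cnt-cong (eq ∘ suc)

cnt-false : ∀ {n} {b : Fin n → Bool} → (∀ i → b i ≡ false) → cnt b ≡ 0
cnt-false {zero}      _   = refl
cnt-false {suc n} {b} all with b zero | all zero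
... | false | refl = cnt-false (all ∘ suc)

cnt-true : ∀ {n} {b : Fin n → Bool} → (∀ i → b i ≡ true) → cnt b ≡ n
cnt-true {zero}      _   = refl
cnt-true {suc n} {b} all with b zero | all zero
... | true | refl = cong suc (cnt-true (all ∘ suc))

cnt-∨ : ∀ {n} {b c : Fin n → Bool} → (∀ i → b i ∧ c i ≡ false) →
        cnt (λ i → b i ∨ c i) ≡ cnt b + cnt c
cnt-∨ {zero}          _        = refl
cnt-∨ {suc n} {b} {c} disjoint with b zero | c zero | disjoint zero
... | true  | false | _ = cong suc (cnt-∨ (disjoint ∘ suc))
... | false | true  | _ = trans (cong suc (cnt-∨ (disjoint ∘ suc))) (sym (+-suc _ _))
... | false | false | _ = cnt-∨ (disjoint ∘ suc)

cnt-≤1 : ∀ {n} {b : Fin n → Bool} → (∀ i j → b i ≡ true → b j ≡ true → i ≡ j) → cnt b ≤ 1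
cnt-≤1 {zero}          _   = z≤n
cnt-≤1 {suc n} {b} one with b zero in b0
... | true  = ≤-reflexive (cong suc (cnt-false only-zero))
  where
  only-zero : ∀ i → b (suc i) ≡ false
  only-zero i with b (suc i) in bi
  ... | false = refl
  ... | true  with () ← one zero (suc i) b0 bi
... | false = cnt-≤1 λ i j bi bj → suc-injective (one (suc i) (suc j) bi bj)

does-cong : ∀ {P Q : Set} → (P → Q) → (Q → P) → (P? : Dec P) (Q? : Dec Q) → does P? ≡ does Q?
does-cong _   _   (yes _) (yes _) = refl
does-cong _   _   (no  _) (no  _) = refl
does-cong P⇒Q _   (yes p) (no ¬q) = ⊥-elim (¬q (P⇒Q p))
does-cong _   Q⇒P (no ¬p) (yes q) = ⊥-elim (¬p (Q⇒P q))

countFin-cong : ∀ {n} {P Q : Pred (Fin n) 0ℓ} (P? : Decidable P) (Q? : Decidable Q) →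
                (∀ x → P x → Q x) → (∀ x → Q x → P x) → countFin P? ≡ countFin Q?
countFin-cong P? Q? P⇒Q Q⇒P = begin
  countFin P?      ≡⟨ countFin≡cnt P? ⟩
  cnt (does ∘ P?)  ≡⟨ cnt-cong (λ x → does-cong (P⇒Q x) (Q⇒P x) (P? x) (Q? x)) ⟩
  cnt (does ∘ Q?)  ≡⟨ countFin≡cnt Q? ⟨
  countFin Q?      ∎

sumTo : ℕ → (ℕ → ℕ) → ℕ
sumTo zero    f = 0
sumTo (suc m) f = sumTo m f + f m

sumTo-cong : ∀ m {f g : ℕ → ℕ} → (∀ a → a < m → f a ≡ g a) → sumTo m f ≡ sumTo m g
sumTo-cong zero    _  = refl
sumTo-cong (suc m) eq = cong₂ _+_ (sumTo-cong m (λ a a<m → eq a (m<n⇒m<1+n a<m))) (eq m (n<1+n m))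

<ᵇ-suc : ∀ a m → (a <ᵇ suc m) ≡ (a <ᵇ m) ∨ (a ≡ᵇ m)
<ᵇ-suc zero    zero    = refl
<ᵇ-suc zero    (suc m) = refl
<ᵇ-suc (suc a) zero    = refl
<ᵇ-suc (suc a) (suc m) = <ᵇ-suc a m

<ᵇ∧≡ᵇ : ∀ a m → (a <ᵇ m) ∧ (a ≡ᵇ m) ≡ false
<ᵇ∧≡ᵇ zero    zero    = refl
<ᵇ∧≡ᵇ zero    (suc m) = refl
<ᵇ∧≡ᵇ (suc a) zero    = refl
<ᵇ∧≡ᵇ (suc a) (suc m) = <ᵇ∧≡ᵇ a m

cnt-<ᵇ : ∀ {n} (q : Fin n → Bool) (h : Fin n → ℕ) m →
         cnt (λ c → q c ∧ (h c <ᵇ m)) ≡ sumTo m (λ a → cnt (λ c → q c ∧ (h c ≡ᵇ a)))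
cnt-<ᵇ q h zero    = cnt-false (λ c → ∧-zeroʳ (q c))
cnt-<ᵇ q h (suc m) = begin
  cnt (λ c → q c ∧ (h c <ᵇ suc m))
    ≡⟨ cnt-cong (λ c → trans (cong (q c ∧_) (<ᵇ-suc (h c) m)) (∧-distribˡ-∨ (q c) _ _)) ⟩
  cnt (λ c → (q c ∧ (h c <ᵇ m)) ∨ (q c ∧ (h c ≡ᵇ m)))
    ≡⟨ cnt-∨ (λ c → disjoint (q c) (h c)) ⟩
  cnt (λ c → q c ∧ (h c <ᵇ m)) + cnt (λ c → q c ∧ (h c ≡ᵇ m))
    ≡⟨ cong (_+ cnt (λ c → q c ∧ (h c ≡ᵇ m))) (cnt-<ᵇ q h m) ⟩
  sumTo (suc m) (λ a → cnt (λ c → q c ∧ (h c ≡ᵇ a))) ∎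
  where
  disjoint : ∀ b x → (b ∧ (x <ᵇ m)) ∧ (b ∧ (x ≡ᵇ m)) ≡ false
  disjoint false _ = refl
  disjoint true  x = <ᵇ∧≡ᵇ x m

sumTo-≤ : ∀ m (f : ℕ → ℕ) → (∀ a → a < m → f a ≤ 1) → sumTo m f ≤ m
sumTo-≤ zero    f _  = z≤n
sumTo-≤ (suc m) f ≤1 = subst (sumTo m f + f m ≤_) (+-comm m 1)
                         (+-mono-≤ (sumTo-≤ m f (λ a a<m → ≤1 a (m<n⇒m<1+n a<m))) (≤1 m (n<1+n m)))

sumTo-tight : ∀ m (f : ℕ → ℕ) → (∀ a → a < m → f a ≤ 1) → sumTo m f ≡ m →
              ∀ a → a < m → f a ≡ 1
sumTo-tight (suc m) f ≤1 total a a<1+m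
  with tight (sumTo-≤ m f (λ b b<m → ≤1 b (m<n⇒m<1+n b<m))) (≤1 m (n<1+n m)) total
  where
  tight : ∀ {x y} → x ≤ m → y ≤ 1 → x + y ≡ suc m → x ≡ m × y ≡ 1
  tight {x} {zero}      x≤m _ eq =
    ⊥-elim (<-irrefl refl (≤-<-trans x≤m (≤-reflexive (trans (sym eq) (+-identityʳ x)))))
  tight {x} {suc zero}  _   _ eq = ℕ.suc-injective (trans (+-comm 1 x) eq) , refl
  tight {y = suc (suc _)} _ (s≤s ()) _
... | sum≡m , fm≡1 with m≤n⇒m<n∨m≡n (≤-pred a<1+m)
...   | inj₁ a<m  = sumTo-tight m f (λ b b<m → ≤1 b (m<n⇒m<1+n b<m)) sum≡m a a<m
...   | inj₂ refl = fm≡1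

sumTo-ones : ∀ m (f : ℕ → ℕ) → (∀ a → a < m → f a ≡ 1) → sumTo m f ≡ m
sumTo-ones zero    f _    = refl
sumTo-ones (suc m) f ones =
  trans (cong₂ _+_ (sumTo-ones m f (λ a a<m → ones a (m<n⇒m<1+n a<m))) (ones m (n<1+n m))) (+-comm m 1)

<⇒<ᵇ≡true : ∀ {a b} → a < b → (a <ᵇ b) ≡ true
<⇒<ᵇ≡true a<b = T-≡ .Equivalence.to (<⇒<ᵇ a<b)

≡ᵇ≡true⇒≡ : ∀ {a b} → (a ≡ᵇ b) ≡ true → a ≡ b
≡ᵇ≡true⇒≡ {a} {b} eq = ≡ᵇ⇒≡ a b (T-≡ .Equivalence.from eq)

-- A permutation σ of Fin n takes exactly v values below v: each value is taken at
-- most once, and n values are taken in all.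
cnt-perm-< : ∀ {n} (σ : Fin n → Fin n) → (∀ i j → σ i ≡ σ j → i ≡ j) →
             ∀ v → v ≤ n → cnt (λ c → toℕ (σ c) <ᵇ v) ≡ v
cnt-perm-< {n} σ σ-injective v v≤n = begin
  cnt (λ c → toℕ (σ c) <ᵇ v)  ≡⟨ cnt-<ᵇ (λ _ → true) (toℕ ∘ σ) v ⟩
  sumTo v taken               ≡⟨ sumTo-ones v taken (λ a a<v → taken≡1 a (<-≤-trans a<v v≤n)) ⟩
  v                           ∎
  where
  taken : ℕ → ℕ
  taken a = cnt (λ c → toℕ (σ c) ≡ᵇ a)

  taken≤1 : ∀ a → a < n → taken a ≤ 1
  taken≤1 a _ = cnt-≤1 λ i j σi≡a σj≡a →
    σ-injective i j (toℕ-injective (trans (≡ᵇ≡true⇒≡ σi≡a) (sym (≡ᵇ≡true⇒≡ σj≡a))))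

  taken≡1 : ∀ a → a < n → taken a ≡ 1
  taken≡1 = sumTo-tight n taken taken≤1
    (trans (sym (cnt-<ᵇ (λ _ → true) (toℕ ∘ σ) n)) (cnt-true (λ c → <⇒<ᵇ≡true (toℕ<n (σ c)))))

countFin-perm-< : ∀ {n} (σ : Fin n → Fin n) → (∀ i j → σ i ≡ σ j → i ≡ j) →
                  ∀ c → countFin (λ c′ → toℕ (σ c′) <? toℕ (σ c)) ≡ toℕ (σ c)
countFin-perm-< σ σ-injective c =
  trans (countFin≡cnt (λ c′ → toℕ (σ c′) <? toℕ (σ c)))
        (cnt-perm-< σ σ-injective (toℕ (σ c)) (<⇒≤ (toℕ<n (σ c))))

countPair : ∀ {n m m′} → (Fin n → Fin m) → (Fin n → Fin m′) → ℕ → ℕ → ℕ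
countPair f g a b = cnt (λ c → (toℕ (f c) ≡ᵇ a) ∧ (toℕ (g c) ≡ᵇ b))

countPair-swap : ∀ {n m m′} (f : Fin n → Fin m) (g : Fin n → Fin m′) a b →
                 countPair f g a b ≡ countPair g f b a
countPair-swap f g a b = cnt-cong λ c → ∧-comm (toℕ (f c) ≡ᵇ a) (toℕ (g c) ≡ᵇ b)

-- The j-th breakpoint counts the points in the blocks before j, split up by their
-- block on the other side.
breakpoint-formula :
  ∀ {n m m′ I} → ValidBreaks n m I →
  (κ : Fin n → Fin n) → (∀ i j → κ i ≡ κ j → i ≡ j) →
  (blk : Fin n → Fin m) → (∀ c → InBlock I (blk c) (toℕ (κ c))) → (other : Fin n → Fin m′) →
  ∀ j → lookup I j ≡ sumTo (toℕ j) (λ a → sumTo m′ (countPair blk other a))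
breakpoint-formula {n} {m} {m′} {I} valid@(_ , _ , mono) κ κ-injective blk blk-∈ other j = begin
  lookup I j
    ≡⟨ cnt-perm-< κ κ-injective (lookup I j) (lookup-≤ {I = I} valid j) ⟨
  cnt (λ c → toℕ (κ c) <ᵇ lookup I j)
    ≡⟨ cnt-cong (λ c → does-cong (Blocks.<-lookup⇒ {I = I} mono (blk-∈ c) j)
                                 (Blocks.<-lookup⇐ {I = I} mono (blk-∈ c) j)
                                 (toℕ (κ c) <? lookup I j) (toℕ (blk c) <? toℕ j)) ⟩
  cnt (λ c → toℕ (blk c) <ᵇ toℕ j)
    ≡⟨ cnt-<ᵇ (λ _ → true) (toℕ ∘ blk) (toℕ j) ⟩
  sumTo (toℕ j) (λ a → cnt (λ c → toℕ (blk c) ≡ᵇ a))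
    ≡⟨ sumTo-cong (toℕ j) (λ a _ →
         trans (cnt-cong λ c → trans (sym (∧-identityʳ _))
                                     (cong ((toℕ (blk c) ≡ᵇ a) ∧_) (sym (<⇒<ᵇ≡true (toℕ<n (other c))))))
               (cnt-<ᵇ (λ c → toℕ (blk c) ≡ᵇ a) (toℕ ∘ other) m′)) ⟩
  sumTo (toℕ j) (λ a → sumTo m′ (countPair blk other a)) ∎

Increasing : ∀ {m m′} → (Fin m → Fin m′) → Set
Increasing e = ∀ a b → toℕ a < toℕ b → toℕ (e a) < toℕ (e b)

increasing-≥ : ∀ {m m′} (e : Fin m → Fin m′) → Increasing e → ∀ a → toℕ a ≤ toℕ (e a)
increasing-≥         e inc zero    = z≤n
increasing-≥ {suc m} e inc (suc a) =
  ≤-<-trans (increasing-≥ (e ∘ inject₁) inc′ a)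
            (inc (inject₁ a) (suc a) (s≤s (≤-reflexive (toℕ-inject₁ a))))
  where
  inc′ : Increasing (e ∘ inject₁)
  inc′ a b a<b =
    inc (inject₁ a) (inject₁ b) (subst₂ _<_ (sym (toℕ-inject₁ a)) (sym (toℕ-inject₁ b)) a<b)

increasing-injective : ∀ {m m′} (e : Fin m → Fin m′) → Increasing e → ∀ a b → e a ≡ e b → a ≡ b
increasing-injective e inc a b ea≡eb with <-cmp (toℕ a) (toℕ b)
... | tri< a<b _ _ = ⊥-elim (<-irrefl (cong toℕ ea≡eb) (inc a b a<b))
... | tri≈ _ a≡b _ = toℕ-injective a≡b
... | tri> _ _ b<a = ⊥-elim (<-irrefl (cong toℕ (sym ea≡eb)) (inc b a b<a))

opposite-< : ∀ {n} {a b : Fin n} → toℕ a < toℕ b → toℕ (opposite b) < toℕ (opposite a)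
opposite-< {a = a} {b} a<b =
  subst₂ _<_ (sym (opposite-prop b)) (sym (opposite-prop a)) (∸-monoʳ-< (s≤s a<b) (toℕ<n b))

-- Applying increasing-≥ to the reversed map opposite ∘ e ∘ opposite gives the upper bound
increasing-endo⇒id : ∀ {n} (e : Fin n → Fin n) → Increasing e → ∀ a → e a ≡ a
increasing-endo⇒id e inc a with <-cmp (toℕ a) (toℕ (e a))
... | tri≈ _ a≡ea _ = sym (toℕ-injective a≡ea)
... | tri> _ _ ea<a = ⊥-elim (<-irrefl refl (<-≤-trans ea<a (increasing-≥ e inc a)))
... | tri< a<ea _ _ = ⊥-elim (<-irrefl refl (<-≤-trans (opposite-< a<ea)
        (subst (λ x → toℕ (opposite a) ≤ toℕ (opposite (e x))) (opposite-involutive a)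
               (increasing-≥ (opposite ∘ e ∘ opposite) reversed (opposite a)))))
  where
  reversed : Increasing (opposite ∘ e ∘ opposite)
  reversed a b a<b = opposite-< (inc (opposite b) (opposite a) (opposite-< a<b))

module PartitionBlocks {r s} {M : Matrix r s} (p : Part M) where
  open Part p public

  π : Fin n → Fin n
  π = lookup perm

  rowBreaks : ValidBreaks n r I
  rowBreaks = proj₁ isPart

  colBreaks : ValidBreaks n s J
  colBreaks = proj₁ (proj₂ isPart)

  module Rows = Blocks {I = I} (proj₂ (proj₂ rowBreaks))
  module Cols = Blocks {I = J} (proj₂ (proj₂ colBreaks))

  rowBlock : Fin n → Fin r
  rowBlock x = proj₁ (inBlock-valid {I = I} rowBreaks (toℕ x) (toℕ<n x))

  colBlock : Fin n → Fin s
  colBlock x = proj₁ (inBlock-valid {I = J} colBreaks (toℕ (π x)) (toℕ<n (π x)))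

  rowBlock-∈ : ∀ x → InBlock I (rowBlock x) (toℕ x)
  rowBlock-∈ x = proj₂ (inBlock-valid {I = I} rowBreaks (toℕ x) (toℕ<n x))

  colBlock-∈ : ∀ x → InBlock J (colBlock x) (toℕ (π x))
  colBlock-∈ x = proj₂ (inBlock-valid {I = J} colBreaks (toℕ (π x)) (toℕ<n (π x)))

  inCell⇒blocks : ∀ {k ℓ x} → InCell perm I J k ℓ x → rowBlock x ≡ k × colBlock x ≡ ℓ
  inCell⇒blocks (x∈k , x∈ℓ) =
    Rows.inBlock-unique (rowBlock-∈ _) x∈k , Cols.inBlock-unique (colBlock-∈ _) x∈ℓ

  blocks⇒inCell : ∀ {k ℓ x} → rowBlock x ≡ k × colBlock x ≡ ℓ → InCell perm I J k ℓ x
  blocks⇒inCell {x = x} (refl , refl) = rowBlock-∈ x , colBlock-∈ x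

module PartitionLines {r s} (M : Matrix r s) (E : LinesOf.LinesElimination M) where
  open LinesOf M
  open LinesElimination E

  stage-injective′ : ∀ {u w} → stage u ≡ stage w → u ≡ w
  stage-injective′ = stage-injective (∈-lines _) (∈-lines _)

  module Points (p : Part M) where
    open PartitionBlocks p public

    SameCell : Fin n → Fin n → Set
    SameCell x y = rowBlock x ≡ rowBlock y × colBlock x ≡ colBlock y

    same-cell⇒inCell : ∀ {x y} → SameCell x y → InCell perm I J (rowBlock x) (colBlock x) y
    same-cell⇒inCell (same-row , same-col) = blocks⇒inCell (sym same-row , sym same-col)

    rowLine colLine : Fin n → Line
    rowLine x = inj₁ (rowBlock x)
    colLine x = inj₂ (colBlock x)

    cell-nonzero : ∀ x → GAdj M (rowLine x) (colLine x)
    cell-nonzero x with M (rowBlock x) (colBlock x) | proj₂ (proj₂ isPart) (rowBlock x) (colBlock x)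
    ... | zer | empty = λ _ → empty x (blocks⇒inCell (refl , refl))
    ... | pos | _     = λ ()
    ... | neg | _     = λ ()

    cell-monotone : ∀ {x y} → SameCell x y → toℕ x < toℕ y →
                    toℕ (π x) <[ not (flips (rowLine x) (colLine x)) ] toℕ (π y)
    cell-monotone {x} {y} same x<y
      with M (rowBlock x) (colBlock x) | proj₂ (proj₂ isPart) (rowBlock x) (colBlock x)
    ... | zer | empty = ⊥-elim (empty x (blocks⇒inCell (refl , refl)))
    ... | pos | incr  = incr x y (blocks⇒inCell (refl , refl)) (same-cell⇒inCell same) x<y
    ... | neg | decr  = decr x y (blocks⇒inCell (refl , refl)) (same-cell⇒inCell same) x<y

    same-cell-sym : ∀ {x y} → SameCell x y → SameCell y x
    same-cell-sym (same-row , same-col) = sym same-row , sym same-col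

    coord : Line → Fin n → ℕ
    coord (inj₁ _) x = toℕ x
    coord (inj₂ _) x = toℕ (π x)

    coord-injective : ∀ u {x y} → coord u x ≡ coord u y → x ≡ y
    coord-injective (inj₁ _) eq = toℕ-injective eq
    coord-injective (inj₂ _) eq = isPerm _ _ (toℕ-injective eq)

    On : Line → Fin n → Set
    On (inj₁ k) x = rowBlock x ≡ k
    On (inj₂ ℓ) x = colBlock x ≡ ℓ

    On? : ∀ u x → Dec (On u x)
    On? (inj₁ k) x = rowBlock x ≟ᶠ k
    On? (inj₂ ℓ) x = colBlock x ≟ᶠ ℓ

    _<⟨_⟩_ : Fin n → Line → Fin n → Set
    x <⟨ u ⟩ y = coord u x <[ direction u ] coord u y

    _<⟨_⟩?_ : ∀ x u y → Dec (x <⟨ u ⟩ y)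
    x <⟨ u ⟩? y = coord u x <[ direction u ]? coord u y

    <⟨⟩-total : ∀ u {x y} → x ≢ y → x <⟨ u ⟩ y ⊎ y <⟨ u ⟩ x
    <⟨⟩-total u x≢y = <[]-total (x≢y ∘ coord-injective u)

    row⇒col : ∀ {x y} → SameCell x y → x <⟨ rowLine x ⟩ y → x <⟨ colLine x ⟩ y
    row⇒col {x} {y} same x<y =
      <[]-twist (flips (rowLine x) (colLine x)) (direction (colLine x))
        (cell-monotone same)
        (λ y<x → subst (λ f → toℕ (π y) <[ not f ] toℕ (π x))
                       (cong₂ flips (cong inj₁ (sym (proj₁ same))) (cong inj₂ (sym (proj₂ same))))
                       (cell-monotone (same-cell-sym same) y<x))
        (subst (λ d → toℕ x <[ d ] toℕ y)
               (direction-consistent (∈-lines (rowLine x)) (∈-lines (colLine x)) (cell-nonzero x)) x<y)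

    col⇒row : ∀ {x y} → SameCell x y → x <⟨ colLine x ⟩ y → x <⟨ rowLine x ⟩ y
    col⇒row {x} {y} same x<y with <⟨⟩-total (rowLine x) (λ { refl → <[]-irrefl x<y })
    ... | inj₁ x<y′ = x<y′
    ... | inj₂ y<x  = ⊥-elim (<[]-irrefl (<[]-trans x<y y<x′))
      where
      y<x′ : y <⟨ colLine x ⟩ x
      y<x′ = subst (λ ℓ → y <⟨ inj₂ ℓ ⟩ x) (sym (proj₂ same))
               (row⇒col (same-cell-sym same) (subst (λ k → y <⟨ inj₁ k ⟩ x) (proj₁ same) y<x))

    Through : Fin n → Line → Line → Set
    Through x u w = (u ≡ rowLine x × w ≡ colLine x) ⊎ (u ≡ colLine x × w ≡ rowLine x)

    through-on : ∀ {x u w} → Through x u w → On u x × On w x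
    through-on (inj₁ (refl , refl)) = refl , refl
    through-on (inj₂ (refl , refl)) = refl , refl

    through-adj : ∀ {x u w} → Through x u w → GAdj M u w
    through-adj {x} (inj₁ (refl , refl)) = cell-nonzero x
    through-adj {x} (inj₂ (refl , refl)) = adj-sym {rowLine x} {colLine x} (cell-nonzero x)

    through-distinct : ∀ {x u w} → Through x u w → u ≢ w
    through-distinct x∈uw refl = adj-irrefl _ (through-adj x∈uw)

    on⇒through : ∀ {u x} → On u x → ∃[ w ] Through x u w
    on⇒through {inj₁ _} refl = _ , inj₁ (refl , refl)
    on⇒through {inj₂ _} refl = _ , inj₂ (refl , refl)

    on-both⇒same-cell : ∀ {x y u w} → Through x u w → On u y → On w y → SameCell x y
    on-both⇒same-cell (inj₁ (refl , refl)) on-u on-w = sym on-u , sym on-w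
    on-both⇒same-cell (inj₂ (refl , refl)) on-u on-w = sym on-w , sym on-u

    same-cell-through : ∀ {x y u w} → SameCell x y → Through x u w → Through y u w
    same-cell-through (same-row , same-col) (inj₁ (refl , refl)) =
      inj₁ (cong inj₁ same-row , cong inj₂ same-col)
    same-cell-through (same-row , same-col) (inj₂ (refl , refl)) =
      inj₂ (cong inj₂ same-col , cong inj₁ same-row)

    through-transfer : ∀ {x y u w} → SameCell x y → Through x u w → x <⟨ u ⟩ y → x <⟨ w ⟩ y
    through-transfer same (inj₁ (refl , refl)) = row⇒col same
    through-transfer same (inj₂ (refl , refl)) = col⇒row same

    child-parent : ∀ x → ∃[ c ] ∃[ q ] (Through x c q × stage q < stage c)
    child-parent x with stage (rowLine x) <? stage (colLine x)
    ... | yes row<col = colLine x , rowLine x , inj₂ (refl , refl) , row<col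
    ... | no  row≮col = rowLine x , colLine x , inj₁ (refl , refl) , ≤∧≢⇒< (≮⇒≥ row≮col) col≢row
      where
      col≢row : stage (colLine x) ≢ stage (rowLine x)
      col≢row eq = through-distinct {x} (inj₁ (refl , refl)) (sym (stage-injective′ eq))

    child parent : Fin n → Line
    child  x = proj₁ (child-parent x)
    parent x = proj₁ (proj₂ (child-parent x))

    through-child-parent : ∀ x → Through x (child x) (parent x)
    through-child-parent x = proj₁ (proj₂ (proj₂ (child-parent x)))

    parent<child : ∀ x → stage (parent x) < stage (child x)
    parent<child x = proj₂ (proj₂ (proj₂ (child-parent x)))

    on⇒child⊎parent : ∀ {u x} → On u x → u ≡ child x ⊎ u ≡ parent x
    on⇒child⊎parent {u} {x} on-u with on⇒through {u} on-u | through-child-parent x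
    ... | _ , inj₁ (refl , _) | inj₁ (c≡ , _) = inj₁ (sym c≡)
    ... | _ , inj₁ (refl , _) | inj₂ (_ , q≡) = inj₂ (sym q≡)
    ... | _ , inj₂ (refl , _) | inj₁ (_ , q≡) = inj₂ (sym q≡)
    ... | _ , inj₂ (refl , _) | inj₂ (c≡ , _) = inj₁ (sym c≡)

    on⇒stage≤child : ∀ {u x} → On u x → stage u ≤ stage (child x)
    on⇒stage≤child {x = x} on-u with on⇒child⊎parent on-u
    ... | inj₁ refl = ≤-refl
    ... | inj₂ refl = <⇒≤ (parent<child x)

    open DecMembership (_≟ᶠ_ {n}) using (_∈?_)

    module AlongLine (u : Line) = Insertion (On? u) (λ x y → x <⟨ u ⟩? y)

    SortedAlongLines : List (Fin n) → Set
    SortedAlongLines L = ∀ u → AlongLine.Sorted u L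

    record Enumeration (t : ℕ) (L : List (Fin n)) : Set where
      field
        unique : Unique L
        staged : ∀ {z} → z ∈ L → stage (child z) ≤ t
        sorted : SortedAlongLines L
    open Enumeration

    -- The other line of b is a neighbour of child x of smaller stage, hence parent x.
    child-line⇒parent-line : ∀ {t L x b} → Enumeration t L → stage (child x) ≡ t →
                             b ∈ L → On (child x) b → On (parent x) b
    child-line⇒parent-line {x = x} {b} E refl b∈L on-child
      with w , b∈cw ← on⇒through on-child =
      subst (λ v → On v b) (sym parent≡w) (proj₂ (through-on b∈cw))
      where
      w<child : stage w < stage (child x)
      w<child = ≤∧≢⇒< (≤-trans (on⇒stage≤child (proj₂ (through-on b∈cw))) (staged E b∈L))
                      (λ eq → through-distinct b∈cw (sym (stage-injective′ eq)))
      parent≡w : parent x ≡ w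
      parent≡w = earlier-neighbour-unique (∈-lines _) (∈-lines _) (∈-lines _)
                   (through-adj (through-child-parent x)) (through-adj b∈cw) (parent<child x) w<child

    add : Fin n → List (Fin n) → List (Fin n)
    add x L with x ∈? L
    ... | yes _ = L
    ... | no  _ = AlongLine.insert (parent x) x L

    module AddPoint {t L x} (E : Enumeration t L) (x-stage : stage (child x) ≡ t) (x∉ : ¬ x ∈ L) where
      open AlongLine (parent x)

      sorted-x : (∀ {z} → z ∈ L → On (parent x) z → z <⟨ parent x ⟩ x → Before z x (insert x L)) ×
                 (∀ {z} → z ∈ L → On (parent x) z → x <⟨ parent x ⟩ z → Before x z (insert x L))
      sorted-x = insert-sorted <[]-trans <[]-irrefl (λ _ _ → <⟨⟩-total (parent x)) x∉ (unique E)
                               (sorted E (parent x)) (proj₂ (through-on (through-child-parent x)))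

      staged′ : ∀ {z} → z ∈ insert x L → stage (child z) ≤ t
      staged′ z∈ with insert-∈ L z∈
      ... | inj₁ refl = ≤-reflexive x-stage
      ... | inj₂ z∈L  = staged E z∈L

      via-parent : ∀ {b} → b ∈ L → On (child x) b → On (parent x) b × SameCell x b
      via-parent b∈L on-child with on-parent ← child-line⇒parent-line E x-stage b∈L on-child =
        on-parent , on-both⇒same-cell (through-child-parent x) on-child on-parent

      x-before : ∀ {u b} → b ∈ L → On u x → On u b → x <⟨ u ⟩ b → Before x b (insert x L)
      x-before {u} b∈L on-x on-b x<b with on⇒child⊎parent {u} on-x
      ... | inj₂ refl = proj₂ sorted-x b∈L on-b x<b
      ... | inj₁ refl with on-parent , same ← via-parent b∈L on-b =
        proj₂ sorted-x b∈L on-parent (through-transfer same (through-child-parent x) x<b)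

      before-x : ∀ {u a} → a ∈ L → On u a → On u x → a <⟨ u ⟩ x → Before a x (insert x L)
      before-x {u} a∈L on-a on-x a<x with on⇒child⊎parent {u} on-x
      ... | inj₂ refl = proj₁ sorted-x a∈L on-a a<x
      ... | inj₁ refl with on-parent , same ← via-parent a∈L on-a =
        proj₁ sorted-x a∈L on-parent
          (through-transfer (same-cell-sym same) (same-cell-through same (through-child-parent x)) a<x)

      sorted′ : SortedAlongLines (insert x L)
      sorted′ u a∈ b∈ on-a on-b a<b with insert-∈ L a∈ | insert-∈ L b∈
      ... | inj₂ a∈L  | inj₂ b∈L  = insert-before (sorted E u a∈L b∈L on-a on-b a<b)
      ... | inj₁ refl | inj₁ refl = ⊥-elim (<[]-irrefl a<b)
      ... | inj₁ refl | inj₂ b∈L  = x-before b∈L on-a on-b a<b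
      ... | inj₂ a∈L  | inj₁ refl = before-x a∈L on-a on-b a<b

      enumeration : Enumeration t (insert x L)
      enumeration = record { unique = insert-unique x∉ (unique E) ; staged = staged′ ; sorted = sorted′ }

    add-enumeration : ∀ {t L x} → Enumeration t L → stage (child x) ≡ t → Enumeration t (add x L)
    add-enumeration {L = L} {x} E x-stage with x ∈? L
    ... | yes _  = E
    ... | no  x∉ = AddPoint.enumeration E x-stage x∉

    add-∈ : ∀ x L → x ∈ add x L
    add-∈ x L with x ∈? L
    ... | yes x∈L = x∈L
    ... | no  _   = AlongLine.insert-new (parent x) x L

    add-old : ∀ {z} x L → z ∈ L → z ∈ add x L
    add-old x L z∈L with x ∈? L
    ... | yes _ = z∈L
    ... | no  _ = AlongLine.insert-old (parent x) L z∈L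

    add-stage : ℕ → List (Fin n) → List (Fin n) → List (Fin n)
    add-stage t []       L = L
    add-stage t (x ∷ xs) L with stage (child x) ≟ t
    ... | yes _ = add-stage t xs (add x L)
    ... | no  _ = add-stage t xs L

    add-stage-enumeration : ∀ {t} xs {L} → Enumeration t L → Enumeration t (add-stage t xs L)
    add-stage-enumeration     []       E = E
    add-stage-enumeration {t} (x ∷ xs) E with stage (child x) ≟ t
    ... | yes x-stage = add-stage-enumeration xs (add-enumeration E x-stage)
    ... | no  _       = add-stage-enumeration xs E

    add-stage-old : ∀ {t z} xs {L} → z ∈ L → z ∈ add-stage t xs L
    add-stage-old     []       z∈L = z∈L
    add-stage-old {t} (x ∷ xs) {L} z∈L with stage (child x) ≟ t
    ... | yes _ = add-stage-old xs (add-old x L z∈L)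
    ... | no  _ = add-stage-old xs z∈L

    add-stage-new : ∀ {t z} xs {L} → z ∈ xs → stage (child z) ≡ t → z ∈ add-stage t xs L
    add-stage-new {t} (x ∷ xs) {L} z∈ z-stage with stage (child x) ≟ t | z∈
    ... | yes _   | here refl = add-stage-old xs (add-∈ x L)
    ... | no  x≢t | here refl = ⊥-elim (x≢t z-stage)
    ... | yes _   | there z∈xs = add-stage-new xs z∈xs z-stage
    ... | no  _   | there z∈xs = add-stage-new xs z∈xs z-stage

    enumerate-below : ℕ → List (Fin n)
    enumerate-below zero    = []
    enumerate-below (suc t) = add-stage t (allFin n) (enumerate-below t)

    enumerate-below-enumeration : ∀ t → Enumeration t (enumerate-below t)
    enumerate-below-enumeration zero    = record { unique = [] ; staged = λ () ; sorted = λ _ () }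
    enumerate-below-enumeration (suc t)
      with E ← add-stage-enumeration (allFin n) (enumerate-below-enumeration t) =
      record { unique = unique E ; staged = m≤n⇒m≤1+n ∘ staged E ; sorted = sorted E }

    enumerate-below-∈ : ∀ t x → stage (child x) < t → x ∈ enumerate-below t
    enumerate-below-∈ (suc t) x x<1+t with m≤n⇒m<n∨m≡n (≤-pred x<1+t)
    ... | inj₁ x<t = add-stage-old (allFin n) (enumerate-below-∈ t x x<t)
    ... | inj₂ x≡t = add-stage-new (allFin n) (∈-allFin x) x≡t

    points : List (Fin n)
    points = enumerate-below (length lines)

    points-unique : Unique points
    points-unique = unique (enumerate-below-enumeration (length lines))

    points-sorted : SortedAlongLines points
    points-sorted = sorted (enumerate-below-enumeration (length lines))

    ∈-points : ∀ x → x ∈ points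
    ∈-points x = enumerate-below-∈ (length lines) x (stage-bounded (∈-lines (child x)))

module Embedding {r s} (M : Matrix r s) (E : LinesOf.LinesElimination M) where
  open LinesOf M using (module LinesElimination)
  open PartitionLines M E
  open LinesElimination E using (direction)

  letter : (p : Part M) → Fin (Part.n p) → Fin (r * s)
  letter p x = combine (Points.rowBlock p x) (Points.colBlock p x)

  word : Part M → List (Fin (r * s))
  word p = map (letter p) (Points.points p)

  module _ (p q : Part M) (embedding : Sublist _≡_ (word p) (word q)) where
    private
      module P = Points p
      module Q = Points q

    matching : Sublist (λ x y → letter p x ≡ letter q y) P.points Q.points
    matching = map⁻ (letter p) (letter q) embedding

    open SublistImage (_≟ᶠ_ {P.n}) {R = λ x y → letter p x ≡ letter q y}

    φ : Fin P.n → Fin Q.n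
    φ x = image matching (P.∈-points x)

    φ-cell : ∀ x → P.rowBlock x ≡ Q.rowBlock (φ x) × P.colBlock x ≡ Q.colBlock (φ x)
    φ-cell x = combine-injective _ _ _ _ (image-R matching (P.∈-points x))

    φ-on : ∀ u {a} → P.On u a → Q.On u (φ a)
    φ-on (inj₁ _) on = trans (sym (proj₁ (φ-cell _))) on
    φ-on (inj₂ _) on = trans (sym (proj₂ (φ-cell _))) on

    φ-<⟨⟩ : ∀ u {a b} → P.On u a → P.On u b → a P.<⟨ u ⟩ b → φ a Q.<⟨ u ⟩ φ b
    φ-<⟨⟩ u {a} {b} on-a on-b a<b = from-total (Q.<⟨⟩-total u φa≢φb)
      where
      listed : Before (φ a) (φ b) Q.points
      listed = image-before matching P.points-unique
                 (P.points-sorted u (P.∈-points a) (P.∈-points b) on-a on-b a<b) _ _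
      φa≢φb : φ a ≢ φ b
      φa≢φb eq = before-irrefl Q.points-unique (subst (λ y → Before (φ a) y Q.points) (sym eq) listed)
      from-total : φ a Q.<⟨ u ⟩ φ b ⊎ φ b Q.<⟨ u ⟩ φ a → φ a Q.<⟨ u ⟩ φ b
      from-total (inj₁ φa<φb) = φa<φb
      from-total (inj₂ φb<φa) = ⊥-elim (before-asym Q.points-unique listed
        (Q.points-sorted u (Q.∈-points _) (Q.∈-points _) (φ-on u on-b) (φ-on u on-a) φb<φa))

    φ-coord-< : ∀ u {a b} → P.On u a → P.On u b →
                P.coord u a < P.coord u b → Q.coord u (φ a) < Q.coord u (φ b)
    φ-coord-< u on-a on-b = <[]⇒< (direction u) (φ-<⟨⟩ u on-a on-b) (φ-<⟨⟩ u on-b on-a)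

    φ-increasing : Increasing φ
    φ-increasing = blockwise-monotone {I = P.I} {Q.I} (proj₂ (proj₂ P.rowBreaks)) (proj₂ (proj₂ Q.rowBreaks))
      toℕ toℕ P.rowBlock Q.rowBlock P.rowBlock-∈ Q.rowBlock-∈ φ (proj₁ ∘ φ-cell)
      (λ a b same → φ-coord-< (inj₁ (P.rowBlock a)) refl (sym same))

    φ-column-< : ∀ a b → toℕ (P.π a) < toℕ (P.π b) → toℕ (Q.π (φ a)) < toℕ (Q.π (φ b))
    φ-column-< = blockwise-monotone {I = P.J} {Q.J} (proj₂ (proj₂ P.colBreaks)) (proj₂ (proj₂ Q.colBreaks))
      (toℕ ∘ P.π) (toℕ ∘ Q.π) P.colBlock Q.colBlock P.colBlock-∈ Q.colBlock-∈ φ (proj₂ ∘ φ-cell)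
      (λ a b same → φ-coord-< (inj₂ (P.colBlock a)) refl (sym same))

    φ-column-<⁻ : ∀ a b → toℕ (Q.π (φ a)) < toℕ (Q.π (φ b)) → toℕ (P.π a) < toℕ (P.π b)
    φ-column-<⁻ a b φa<φb with <-cmp (toℕ (P.π a)) (toℕ (P.π b))
    ... | tri< a<b _ _ = a<b
    ... | tri≈ _ a≡b _ with refl ← P.isPerm a b (toℕ-injective a≡b) = ⊥-elim (<-irrefl refl φa<φb)
    ... | tri> _ _ b<a = ⊥-elim (<-irrefl refl (<-trans φa<φb (φ-column-< b a b<a)))

    φ-inCell : ∀ k ℓ c → InCell Q.perm Q.I Q.J k ℓ (φ c) ⇔ InCell P.perm P.I P.J k ℓ c
    φ-inCell k ℓ c = mk⇔
      (λ in-q → let row , col = Q.inCell⇒blocks in-q in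
                P.blocks⇒inCell (trans (proj₁ (φ-cell c)) row , trans (proj₂ (φ-cell c)) col))
      (λ in-p → let row , col = P.inCell⇒blocks in-p in
                Q.blocks⇒inCell (trans (sym (proj₁ (φ-cell c))) row , trans (sym (proj₂ (φ-cell c))) col))

    embedding⇒⪯ : p ⪯ q
    embedding⇒⪯ = φ , φ-increasing , rank , cells
      where
      rank : ∀ c → toℕ (P.π c) ≡ countFin (λ c′ → toℕ (Q.π (φ c′)) <? toℕ (Q.π (φ c)))
      rank c = sym (trans (countFin-cong _ (λ c′ → toℕ (P.π c′) <? toℕ (P.π c))
                                         (λ c′ → φ-column-<⁻ c′ c) (λ c′ → φ-column-< c′ c))
                          (countFin-perm-< P.π P.isPerm c))
      cells : ∀ k ℓ → countFin (λ c → inCell? Q.perm Q.I Q.J k ℓ (φ c)) ≡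
                      countFin (inCell? P.perm P.I P.J k ℓ)
      cells k ℓ = countFin-cong _ _ (Equivalence.to ∘ φ-inCell k ℓ) (Equivalence.from ∘ φ-inCell k ℓ)

vec-ext : ∀ {A : Set} {m} {u v : Vec A m} → (∀ i → lookup u i ≡ lookup v i) → u ≡ v
vec-ext {u = u} {v} eq = trans (sym (tabulate∘lookup u)) (trans (tabulate-cong eq) (tabulate∘lookup v))

module _ {r s} {M : Matrix r s} where

  cellCount : Part M → ℕ → ℕ → ℕ
  cellCount p = countPair rowBlock colBlock
    where open PartitionBlocks p

  cellCount-toℕ : ∀ p k ℓ →
                  cellCount p (toℕ k) (toℕ ℓ) ≡ countFin (inCell? (Part.perm p) (Part.I p) (Part.J p) k ℓ)
  cellCount-toℕ p k ℓ =
    trans (cnt-cong λ c → does-cong (blocks⇒inCell ∘ map-× toℕ-injective toℕ-injective)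
                                    (map-× (cong toℕ) (cong toℕ) ∘ inCell⇒blocks)
                                    (toℕ (rowBlock c) ≟ toℕ k ×-dec toℕ (colBlock c) ≟ toℕ ℓ)
                                    (inCell? perm I J k ℓ c))
          (sym (countFin≡cnt (inCell? perm I J k ℓ)))
    where open PartitionBlocks p

  row-breaks-formula : ∀ p j → lookup (Part.I p) j ≡ sumTo (toℕ j) (λ a → sumTo s (cellCount p a))
  row-breaks-formula p = breakpoint-formula {I = I} rowBreaks id (λ _ _ → id) rowBlock rowBlock-∈ colBlock
    where open PartitionBlocks p

  col-breaks-formula : ∀ p j → lookup (Part.J p) j ≡ sumTo (toℕ j) (λ b → sumTo r (λ a → cellCount p a b))
  col-breaks-formula p j =
    trans (breakpoint-formula {I = J} colBreaks π isPerm colBlock colBlock-∈ rowBlock j)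
          (sumTo-cong (toℕ j) λ b _ → sumTo-cong r λ a _ → countPair-swap colBlock rowBlock b a)
    where open PartitionBlocks p

  -- An embedding of p′ into p of the same size is the identity, and then the cell
  -- counts determine the breakpoints.
  ⪯-same-size⇒≡ : ∀ (p′ p : Part M) → p′ ⪯ p → Part.n p′ ≡ Part.n p → dataOf p′ ≡ dataOf p
  ⪯-same-size⇒≡ p′@(part n π′ _ I′ J′ _) p@(part .n π π-injective I J _)
                (e , e-increasing , ranks , cells) refl
    = same-data (vec-ext π′≗π) (vec-ext I′≗I) (vec-ext J′≗J)
    where
    below : ∀ {m a} {j : Fin (suc m)} → a < toℕ j → a < m
    below {j = j} a<j = <-≤-trans a<j (≤-pred (toℕ<n j))

    e≗id : ∀ c → e c ≡ c
    e≗id = increasing-endo⇒id e e-increasing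

    π′≗π : ∀ c → lookup π′ c ≡ lookup π c
    π′≗π c = toℕ-injective (begin
      toℕ (lookup π′ c)
        ≡⟨ ranks c ⟩
      countFin (λ c′ → toℕ (lookup π (e c′)) <? toℕ (lookup π (e c)))
        ≡⟨ countFin-cong _ _ (λ c′ → subst₂ π-< (e≗id c′) (e≗id c))
                             (λ c′ → subst₂ π-< (sym (e≗id c′)) (sym (e≗id c))) ⟩
      countFin (λ c′ → toℕ (lookup π c′) <? toℕ (lookup π c))
        ≡⟨ countFin-perm-< (lookup π) π-injective c ⟩
      toℕ (lookup π c)
        ∎)
      where
      π-< : Fin n → Fin n → Set
      π-< x y = toℕ (lookup π x) < toℕ (lookup π y)

    cellCount≡ : ∀ a b → a < r → b < s → cellCount p′ a b ≡ cellCount p a b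
    cellCount≡ a b a<r b<s = begin
      cellCount p′ a b
        ≡⟨ cong₂ (cellCount p′) (toℕ-fromℕ< a<r) (toℕ-fromℕ< b<s) ⟨
      cellCount p′ (toℕ k) (toℕ ℓ)
        ≡⟨ cellCount-toℕ p′ k ℓ ⟩
      countFin (inCell? π′ I′ J′ k ℓ)
        ≡⟨ cells k ℓ ⟨
      countFin (λ c → inCell? π I J k ℓ (e c))
        ≡⟨ countFin-cong _ _ (λ c → subst (InCell π I J k ℓ) (e≗id c))
                             (λ c → subst (InCell π I J k ℓ) (sym (e≗id c))) ⟩
      countFin (inCell? π I J k ℓ)
        ≡⟨ cellCount-toℕ p k ℓ ⟨
      cellCount p (toℕ k) (toℕ ℓ)
        ≡⟨ cong₂ (cellCount p) (toℕ-fromℕ< a<r) (toℕ-fromℕ< b<s) ⟩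
      cellCount p a b
        ∎
      where
      k : Fin r
      k = fromℕ< a<r
      ℓ : Fin s
      ℓ = fromℕ< b<s

    I′≗I : ∀ j → lookup I′ j ≡ lookup I j
    I′≗I j = trans (row-breaks-formula p′ j)
               (trans (sumTo-cong (toℕ j) λ a a<j → sumTo-cong s λ b b<s → cellCount≡ a b (below a<j) b<s)
                      (sym (row-breaks-formula p j)))

    J′≗J : ∀ j → lookup J′ j ≡ lookup J j
    J′≗J j = trans (col-breaks-formula p′ j)
               (trans (sumTo-cong (toℕ j) λ b b<j → sumTo-cong r λ a a<r → cellCount≡ a b a<r (below b<j))
                      (sym (col-breaks-formula p j)))

    same-data : π′ ≡ π → I′ ≡ I → J′ ≡ J → dataOf p′ ≡ dataOf p
    same-data refl refl refl = refl

  ≺⇒smaller : ∀ (p′ p : Part M) → p′ ≺ p → Part.n p′ < Part.n p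
  ≺⇒smaller p′ p (p′⪯p@(e , e-increasing , _) , p′≢p) =
    ≤∧≢⇒< (injective⇒≤ (increasing-injective e e-increasing _ _)) (p′≢p ∘ ⪯-same-size⇒≡ p′ p p′⪯p)

no-infinite-descent-ℕ : (g : ℕ → ℕ) → ¬ (∀ i → g (suc i) < g i)
no-infinite-descent-ℕ g descends = from (<-wellFounded (g 0))
  where
  from : ∀ {i} → Acc _<_ (g i) → ⊥
  from {i} (acc rec) = from (rec (descends i))

theorem3p3 : (r s : ℕ) (M : Matrix r s) → GIsForest M → PartiallyWellOrdered M
theorem3p3 r s M forest = no-antichain , no-descent
  where
  open Embedding M (LinesOf.lines-elimination M forest)

  no-antichain : NoInfiniteAntichain M
  no-antichain (f , incomparable) with i , j , i<j , embeds ← Higman.higman (r * s) (word ∘ f) =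
    incomparable i j (<⇒≢ i<j) (embedding⇒⪯ (f i) (f j) embeds)

  no-descent : NoInfiniteDescent M
  no-descent (f , descends) =
    no-infinite-descent-ℕ (Part.n ∘ f) (λ i → ≺⇒smaller (f (suc i)) (f i) (descends i))
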